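{- For every integer $n\geq 3$, the number of spanning quasi-trees of the bouquet $\mathbb{W}^{1}_n$ is $\kappa(\mathbb{W}^{1}_n)=2f_{n+1}-1+(-1)^{n+1}$.
   Context: A bouquet is a ribbon graph (surface with boundary made of vertex discs and edge ribbons) with exactly one vertex. A quasi-tree is a ribbon graph with exactly one boundary component; $\kappa(G)$ is the number of $F\subseteq E(G)$ such that the spanning ribbon subgraph $(V(G),F)$ (delete edges outside $F$) is a quasi-tree. A bouquet with edges $1,\dots,n$ is given by a signed rotation: a cyclic sequence in which each label occurs twice, recording the order in which the edge ends meet the vertex boundary; occurrences may carry a minus sign (plus omitted), and edge $i$ is an orientable loop iff its two occurrences have the same sign, non-orientable otherwise. For $n\geq3$, $\mathbb{W}_n$ has signed rotation $1,n$, followed by $i,i-1$ for $i=2,\dots,n$, i.e. $(1,n,2,1,3,2,4,3,\dots,n,n-1)$, and $\mathbb{W}^{1}_n$ is obtained by adding a half-twist to edge $1$: signed rotation $(-1,n,2,1,3,2,\dots,n,n-1)$. Fibonacci numbers: $f_1=f_2=1$, $f_k=f_{k-1}+f_{k-2}$. -}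

module Defs where

open import Data.Nat using (ℕ; zero; suc; _+_; _*_; _∸_; _≡ᵇ_; _≤ᵇ_)
open import Data.Bool using (Bool; true; false; if_then_else_; _∧_; not)
open import Data.List using (List; []; _∷_; length; map; upTo; concatMap; _++_; foldr)
open import Data.Product using (_×_; _,_; proj₁; proj₂)

fib : ℕ → ℕ
fib 0 = 0
fib 1 = 1
fib (suc (suc k)) = fib (suc k) + fib k

-- An occurrence of an edge end is (label , sign); sign true = "+", false = "−".
-- A bouquet is given by its signed rotation: the cyclic list of edge-end
-- occurrences (each label occurs exactly twice), starting anywhere.

Occ : Set
Occ = ℕ × Bool

SignedRotation : Set
SignedRotation = List Occ

_==_ : ℕ → ℕ → Bool
_==_ = _≡ᵇ_

countB : {A : Set} → (A → Bool) → List A → ℕ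
countB p [] = 0
countB p (x ∷ xs) = (if p x then 1 else 0) + countB p xs

allB : {A : Set} → (A → Bool) → List A → Bool
allB p [] = true
allB p (x ∷ xs) = p x ∧ allB p xs

nth : List Occ → ℕ → Occ
nth [] _ = (0 , true)
nth (x ∷ xs) zero = x
nth (x ∷ xs) (suc i) = nth xs i

filterB : {A : Set} → (A → Bool) → List A → List A
filterB p [] = []
filterB p (x ∷ xs) = if p x then x ∷ filterB p xs else filterB p xs

iterateN : {A : Set} → ℕ → (A → A) → A → List A
iterateN zero f x = []
iterateN (suc k) f x = x ∷ iterateN k f (f x)

-- Positions p = 0 .. len-1 along the vertex boundary; the edge end at
-- position p occupies an interval of the vertex boundary with a start
-- corner (p , false) and an end corner (p , true) (in the cyclic order).
-- The boundary of the ribbon graph is the union of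
--   * vertex-boundary arcs: end corner of p  —  start corner of p+1 (cyclically),
--   * edge sides: for an edge with ends at positions p and q,
--       untwisted (equal signs):   start p — end q ,  end p — start q,
--       twisted (different signs): start p — start q , end p — end q.
-- Boundary components are the connected components of this graph
-- (a 2-regular graph on the corners).  If there are no edges, the
-- boundary is the single boundary circle of the vertex disc.

sameSign : Bool → Bool → Bool
sameSign true true = true
sameSign false false = true
sameSign _ _ = false

Corner : Set
Corner = ℕ × Bool

module Boundary (L : SignedRotation) where

  len : ℕ
  len = length L

  positions : List ℕ
  positions = upTo len

  nextPos : ℕ → ℕ
  nextPos p = if suc p == len then 0 else suc p

  prevPos : ℕ → ℕ
  prevPos zero = len ∸ 1
  prevPos (suc p) = p

  partnerPos : ℕ → ℕ
  partnerPos p with filterB (λ q → not (q == p) ∧ (proj₁ (nth L q) == proj₁ (nth L p))) positions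
  ... | [] = p
  ... | q ∷ _ = q

  arc : Corner → Corner
  arc (p , true)  = (nextPos p , false)
  arc (p , false) = (prevPos p , true)

  side : Corner → Corner
  side (p , b) =
    let q = partnerPos p in
    if sameSign (proj₂ (nth L p)) (proj₂ (nth L q))
    then (q , not b)
    else (q , b)

  corners : List Corner
  corners = concatMap (λ p → (p , false) ∷ (p , true) ∷ []) positions

  code : Corner → ℕ
  code (p , b) = 2 * p + (if b then 1 else 0)

  component : Corner → List Corner
  component c = let cs = iterateN (2 * len) (λ x → side (arc x)) c in cs ++ map arc cs

  isRep : Corner → Bool
  isRep c = allB (λ d → code c ≤ᵇ code d) (component c)

  boundaryComponents : ℕ
  boundaryComponents with len
  ... | zero = 1
  ... | suc _ = countB isRep corners

boundaryComponents : SignedRotation → ℕ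
boundaryComponents L = Boundary.boundaryComponents L

-- Spanning ribbon subgraphs and spanning quasi-trees.
-- Edges are labelled 1..n; a subset F ⊆ E is a list of n booleans,
-- entry i-1 saying whether edge i belongs to F.

inSubset : List Bool → ℕ → Bool
inSubset [] _ = false
inSubset (b ∷ bs) zero = false
inSubset (b ∷ bs) 1 = b
inSubset (b ∷ bs) (suc (suc i)) = inSubset bs (suc i)

restrict : List Bool → SignedRotation → SignedRotation
restrict F [] = []
restrict F (o ∷ os) = if inSubset F (proj₁ o) then o ∷ restrict F os else restrict F os

allSubsets : ℕ → List (List Bool)
allSubsets zero = [] ∷ []
allSubsets (suc n) = map (true ∷_) (allSubsets n) ++ map (false ∷_) (allSubsets n)

isQuasiTree : SignedRotation → Bool
isQuasiTree L = boundaryComponents L == 1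

κ : ℕ → SignedRotation → ℕ
κ n G = countB (λ F → isQuasiTree (restrict F G)) (allSubsets n)

wTail : ℕ → List Occ
wTail n = concatMap (λ k → (k + 2 , true) ∷ (k + 1 , true) ∷ []) (upTo (n ∸ 1))

W : ℕ → SignedRotation
W n = (1 , true) ∷ (n , true) ∷ wTail n

W¹ : ℕ → SignedRotation
W¹ n = (1 , false) ∷ (n , true) ∷ wTail n

{-# OPTIONS --safe #-}
-- F is a spanning quasi-tree iff the corner graph of restrict F L (vertex arcs and edge sides,
-- a 2-regular graph whose cycles are the boundary components) is connected.  We draw that graph on
-- the corners of L itself, letting a deleted edge end join its own two corners; this does not
-- change connectivity.  In W¹ₙ the chord of edge j + 1 joins positions 2j and 2j + 3, so the corner
-- graph is a cyclic chain of n blocks of four corners, and scanning it block by block is a transfer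
-- matrix: after block s at most six path ends cross the cut, and a state records which crossing
-- edges are kept and how the paths pair up their ends.  This yields a 12-state automaton reading F,
-- each of whose steps is certified by a finite Boolean check, and a subset is a quasi-tree iff it
-- is accepted.  The accepted words of each length satisfy Fibonacci recurrences; the two states
-- whose counts depend on the parity of the length produce the term (-1)ⁿ⁺¹.
module Submission where

module Boundaries where

  open import Defs
  open import Data.Nat using (ℕ; zero; suc; _+_; _*_; _∸_; _≤_; _<_; z≤n; s≤s; z<s; _≡ᵇ_; _≤ᵇ_)
  open import Data.Nat.Properties
  open import Data.Nat.DivMod using (_%_; _/_; m≡m%n+[m/n]*n; m%n<n)
  open import Data.Bool using (Bool; true; false; if_then_else_; _∧_; not; T)
  open import Data.Bool.Properties using (not-involutive)
  open import Data.Fin using (Fin; toℕ; fromℕ<)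
  open import Data.Fin.Properties using (pigeonhole; toℕ-fromℕ<; toℕ<n)
  open import Data.List using (List; []; _∷_; length; map; concatMap; applyUpTo)
  open import Data.List.Membership.Propositional using (_∈_; find; lose)
  open import Data.List.Membership.Propositional.Properties using (∈-++⁺ˡ; ∈-++⁺ʳ; ∈-++⁻; ∈-map⁺; ∈-map⁻; ∈-applyUpTo⁺; ∈-applyUpTo⁻; ∈-concatMap⁺; ∈-concatMap⁻)
  open import Data.List.Relation.Unary.Any using (here; there)
  open import Data.Product using (_×_; _,_; proj₁; proj₂; ∃; ∃₂)
  open import Data.Sum using (_⊎_; inj₁; inj₂)
  open import Data.Empty using (⊥-elim)
  open import Relation.Binary.PropositionalEquality
  open import Relation.Binary.Definitions using (tri<; tri≈; tri>)
  open import Relation.Nullary using (¬_)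

  -- Boundary components of a bouquet

  module Reachability {V : Set} (valid : V → Set) (f g : V → V) where

    data Conn : V → V → Set where
      done : ∀ {x} → Conn x x
      f-step : ∀ {x z} → valid x → Conn (f x) z → Conn x z
      g-step : ∀ {x z} → valid x → Conn (g x) z → Conn x z

    Closed : (V → Set) → Set
    Closed S = ∀ x → valid x → S x → S (f x) × S (g x)

    Closed-Conn : ∀ {S} → Closed S → ∀ {x y} → Conn x y → S x → S y
    Closed-Conn cl done s = s
    Closed-Conn cl (f-step v c) s = Closed-Conn cl c (proj₁ (cl _ v s))
    Closed-Conn cl (g-step v c) s = Closed-Conn cl c (proj₂ (cl _ v s))

    Conn-trans : ∀ {x y z} → Conn x y → Conn y z → Conn x z
    Conn-trans done d = d
    Conn-trans (f-step v c) d = f-step v (Conn-trans c d)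
    Conn-trans (g-step v c) d = g-step v (Conn-trans c d)

    module Involutive (f-valid : ∀ x → valid x → valid (f x)) (g-valid : ∀ x → valid x → valid (g x))
                      (f-involutive : ∀ x → valid x → f (f x) ≡ x) (g-involutive : ∀ x → valid x → g (g x) ≡ x) where

      Conn-sym : ∀ {x y} → valid x → Conn x y → Conn y x
      Conn-sym v done = done
      Conn-sym {x} v (f-step _ c) =
        Conn-trans (Conn-sym (f-valid _ v) c) (f-step (f-valid _ v) (subst (λ w → Conn w x) (sym (f-involutive x v)) done))
      Conn-sym {x} v (g-step _ c) =
        Conn-trans (Conn-sym (g-valid _ v) c) (g-step (g-valid _ v) (subst (λ w → Conn w x) (sym (g-involutive x v)) done))

  -- written as in countB and Boundary.code, so that it agrees with them definitionally
  bit : Bool → ℕ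
  bit b = if b then 1 else 0

  flipIf : Bool → Bool → Bool
  flipIf s b = if s then not b else b

  flipIf-involutive : ∀ s b → flipIf s (flipIf s b) ≡ b
  flipIf-involutive true b = not-involutive b
  flipIf-involutive false b = refl

  bit≤1 : ∀ b → bit b ≤ 1
  bit≤1 true = s≤s z≤n
  bit≤1 false = z≤n

  ==⇒≡ : ∀ a b → (a == b) ≡ true → a ≡ b
  ==⇒≡ a b e = ≡ᵇ⇒≡ a b (subst T (sym e) _)

  ≡⇒== : ∀ a b → a ≡ b → (a == b) ≡ true
  ≡⇒== a b e with a == b in eq
  ... | true = refl
  ... | false = ⊥-elim (subst T eq (≡⇒≡ᵇ a b e))

  ≢⇒== : ∀ a b → a ≢ b → (a == b) ≡ false
  ≢⇒== a b ne with a == b in eq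
  ... | true = ⊥-elim (ne (==⇒≡ a b eq))
  ... | false = refl

  sameSign-comm : ∀ a b → sameSign a b ≡ sameSign b a
  sameSign-comm true true = refl
  sameSign-comm true false = refl
  sameSign-comm false true = refl
  sameSign-comm false false = refl

  allB-false : ∀ {A : Set} (p : A → Bool) xs → allB p xs ≡ false → ∃ λ x → x ∈ xs × p x ≡ false
  allB-false p (x ∷ xs) e with p x in px
  ... | false = x , here refl , px
  ... | true with allB-false p xs e
  ... | y , m , q = y , there m , q

  allB-∈-false : ∀ {A : Set} (p : A → Bool) {xs x} → x ∈ xs → p x ≡ false → allB p xs ≡ false
  allB-∈-false p {y ∷ _} (here refl) e rewrite e = refl
  allB-∈-false p {y ∷ _} (there m) e with p y
  ... | true = allB-∈-false p m e
  ... | false = refl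

  allB-const-true : ∀ {A : Set} (xs : List A) → allB (λ _ → true) xs ≡ true
  allB-const-true [] = refl
  allB-const-true (x ∷ xs) = allB-const-true xs

  countB-∈-true : ∀ {A : Set} (p : A → Bool) {xs x} → x ∈ xs → p x ≡ true → 1 ≤ countB p xs
  countB-∈-true p (here refl) e rewrite e = s≤s z≤n
  countB-∈-true p {y ∷ _} (there m) e = ≤-trans (countB-∈-true p m e) (m≤n+m _ (bit (p y)))

  countB-all-false : ∀ {A : Set} (p : A → Bool) xs → (∀ x → x ∈ xs → p x ≡ false) → countB p xs ≡ 0
  countB-all-false p [] h = refl
  countB-all-false p (y ∷ xs) h rewrite h y (here refl) = countB-all-false p xs (λ x m → h x (there m))

  2*-suc : ∀ p x → 2 * suc p + x ≡ suc (suc (2 * p + x))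
  2*-suc p x = cong (_+ x) (*-suc 2 p)

  2*+bit-injective : ∀ p q x y → 2 * p + bit x ≡ 2 * q + bit y → p ≡ q × x ≡ y
  2*+bit-injective zero zero false false e = refl , refl
  2*+bit-injective zero zero true true e = refl , refl
  2*+bit-injective zero (suc q) x y e =
    ⊥-elim (<⇒≱ (s≤s (s≤s z≤n)) (subst (_≤ 1) (trans e (2*-suc q (bit y))) (bit≤1 x)))
  2*+bit-injective (suc p) zero x y e =
    ⊥-elim (<⇒≱ (s≤s (s≤s z≤n)) (subst (_≤ 1) (trans (sym e) (2*-suc p (bit x))) (bit≤1 y)))
  2*+bit-injective (suc p) (suc q) x y e
    with 2*+bit-injective p q x y (suc-injective (suc-injective (trans (sym (2*-suc p (bit x))) (trans e (2*-suc q (bit y))))))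
  ... | refl , r = refl , r

  module NonEmptyBoundary (o : Occ) (os : List Occ) where
    open Boundary (o ∷ os) public

    valid : Corner → Set
    valid c = proj₁ c < len

    open Reachability valid arc side public

    sign : ℕ → Bool
    sign p = proj₂ (nth (o ∷ os) p)

    side≡ : ∀ p b → side (p , b) ≡ (partnerPos p , flipIf (sameSign (sign p) (sign (partnerPos p))) b)
    side≡ p b with sameSign (sign p) (sign (partnerPos p))
    ... | true = refl
    ... | false = refl

    nextPos< : ∀ p → p < len → nextPos p < len
    nextPos< p p< with suc p ≡ᵇ len in eq
    ... | true = s≤s z≤n
    ... | false = ≤∧≢⇒< p< (λ e → subst T eq (≡⇒≡ᵇ (suc p) len e))

    prevPos< : ∀ p → p < len → prevPos p < len
    prevPos< zero p< = ≤-refl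
    prevPos< (suc p) p< = <-trans (n<1+n p) p<

    arc-valid : ∀ c → valid c → valid (arc c)
    arc-valid (p , true) v = nextPos< p v
    arc-valid (p , false) v = prevPos< p v

    arc-involutive : ∀ c → valid c → arc (arc c) ≡ c
    arc-involutive (p , true) v with suc p ≡ᵇ len in eq
    ... | true = cong (_, true) (cong (_∸ 1) (sym (≡ᵇ⇒≡ (suc p) len (subst T (sym eq) _))))
    ... | false = refl
    arc-involutive (zero , false) v with suc (length os) ≡ᵇ len in eq
    ... | true = refl
    ... | false = ⊥-elim (subst T eq (≡⇒≡ᵇ len len refl))
    arc-involutive (suc p , false) v with suc p ≡ᵇ len in eq
    ... | true = ⊥-elim (<⇒≢ v (≡ᵇ⇒≡ (suc p) len (subst T (sym eq) _)))
    ... | false = refl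

    code-injective : ∀ c d → code c ≡ code d → c ≡ d
    code-injective (p , x) (q , y) e with 2*+bit-injective p q x y e
    ... | refl , refl = refl

    code< : ∀ c → valid c → code c < 2 * len
    code< (p , b) v = begin-strict
      2 * p + bit b   ≤⟨ +-monoʳ-≤ (2 * p) (bit≤1 b) ⟩
      2 * p + 1       ≡⟨ +-comm (2 * p) 1 ⟩
      suc (2 * p)     <⟨ n<1+n _ ⟩
      2 + 2 * p       ≡⟨ sym (*-suc 2 p) ⟩
      2 * suc p       ≤⟨ *-monoʳ-≤ 2 v ⟩
      2 * len         ∎
      where open ≤-Reasoning

    module Paired (partner< : ∀ p → p < len → partnerPos p < len)
                  (partner-involutive : ∀ p → p < len → partnerPos (partnerPos p) ≡ p) where

      side-valid : ∀ c → valid c → valid (side c)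
      side-valid (p , b) v rewrite side≡ p b = partner< p v

      side-involutive : ∀ c → valid c → side (side c) ≡ c
      side-involutive (p , b) v
        rewrite side≡ p b | side≡ (partnerPos p) (flipIf (sameSign (sign p) (sign (partnerPos p))) b)
              | partner-involutive p v | sameSign-comm (sign (partnerPos p)) (sign p)
        = cong (p ,_) (flipIf-involutive (sameSign (sign p) (sign (partnerPos p))) b)

      open Involutive arc-valid side-valid arc-involutive side-involutive public

      step : Corner → Corner
      step c = side (arc c)

      step-valid : ∀ c → valid c → valid (step c)
      step-valid c v = side-valid (arc c) (arc-valid c v)

      step-injective : ∀ x y → valid x → valid y → step x ≡ step y → x ≡ y
      step-injective x y vx vy e = begin
        x                     ≡⟨ sym (arc-involutive x vx) ⟩
        arc (arc x)           ≡⟨ cong arc (sym (side-involutive (arc x) (arc-valid x vx))) ⟩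
        arc (side (step x))   ≡⟨ cong (λ z → arc (side z)) e ⟩
        arc (side (step y))   ≡⟨ cong arc (side-involutive (arc y) (arc-valid y vy)) ⟩
        arc (arc y)           ≡⟨ arc-involutive y vy ⟩
        y                     ∎
        where open ≡-Reasoning

      walk : ℕ → Corner → Corner
      walk zero c = c
      walk (suc k) c = walk k (step c)

      walk-valid : ∀ k c → valid c → valid (walk k c)
      walk-valid zero c v = v
      walk-valid (suc k) c v = walk-valid k (step c) (step-valid c v)

      walk-+ : ∀ a b c → walk (a + b) c ≡ walk b (walk a c)
      walk-+ zero b c = refl
      walk-+ (suc a) b c = walk-+ a b (step c)

      walk-suc : ∀ k c → walk (suc k) c ≡ step (walk k c)
      walk-suc zero c = refl
      walk-suc (suc k) c = walk-suc k (step c)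

      walk-injective : ∀ k x y → valid x → valid y → walk k x ≡ walk k y → x ≡ y
      walk-injective zero x y vx vy e = e
      walk-injective (suc k) x y vx vy e =
        step-injective x y vx vy (walk-injective k (step x) (step y) (step-valid x vx) (step-valid y vy) e)

      Period : Corner → Set
      Period c = ∃ λ p → 0 < p × p ≤ 2 * len × walk p c ≡ c

      -- Pigeonhole on the 2·len + 1 corners walk 0 c, …, walk (2·len) c.
      period : ∀ c → valid c → Period c
      period c v = from-collision (pigeonhole (n<1+n (2 * len)) codeOfWalk)
        where
          codeOfWalk : Fin (suc (2 * len)) → Fin (2 * len)
          codeOfWalk i = fromℕ< (code< (walk (toℕ i) c) (walk-valid (toℕ i) c v))

          from-collision : (∃₂ λ i j → Data.Fin._<_ i j × codeOfWalk i ≡ codeOfWalk j) → Period c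
          from-collision (i , j , i<j , e) = toℕ j ∸ toℕ i , m<n⇒0<n∸m i<j , ≤-trans (m∸n≤m (toℕ j) (toℕ i)) (≤-pred (toℕ<n j)) ,
            sym (walk-injective (toℕ i) c (walk (toℕ j ∸ toℕ i) c) v (walk-valid (toℕ j ∸ toℕ i) c v) (begin
              walk (toℕ i) c                            ≡⟨ code-injective _ _ (trans (sym (toℕ-fromℕ< _)) (trans (cong toℕ e) (toℕ-fromℕ< _))) ⟩
              walk (toℕ j) c                            ≡⟨ cong (λ z → walk z c) (sym (m∸n+n≡m (<⇒≤ i<j))) ⟩
              walk ((toℕ j ∸ toℕ i) + toℕ i) c          ≡⟨ walk-+ (toℕ j ∸ toℕ i) (toℕ i) c ⟩
              walk (toℕ i) (walk (toℕ j ∸ toℕ i) c)     ∎))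
            where open ≡-Reasoning

      walk-* : ∀ p q x → walk p x ≡ x → walk (q * p) x ≡ x
      walk-* p zero x e = refl
      walk-* p (suc q) x e = trans (walk-+ p (q * p) x) (trans (cong (walk (q * p)) e) (walk-* p q x e))

      walk-mod : ∀ c → Period c → ∀ i → ∃ λ i′ → i′ < 2 * len × walk i c ≡ walk i′ c
      walk-mod c (suc p , _ , p≤ , e) i = i % suc p , <-≤-trans (m%n<n i (suc p)) p≤ , (begin
        walk i c                                 ≡⟨ cong (λ z → walk z c) (m≡m%n+[m/n]*n i (suc p)) ⟩
        walk (r + (i / suc p) * suc p) c         ≡⟨ walk-+ r ((i / suc p) * suc p) c ⟩
        walk ((i / suc p) * suc p) (walk r c)    ≡⟨ walk-* (suc p) (i / suc p) (walk r c) periodic ⟩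
        walk r c                                 ∎)
        where
          open ≡-Reasoning
          r = i % suc p
          periodic : walk (suc p) (walk r c) ≡ walk r c
          periodic = begin
            walk (suc p) (walk r c)   ≡⟨ sym (walk-+ r (suc p) c) ⟩
            walk (r + suc p) c        ≡⟨ cong (λ z → walk z c) (+-comm r (suc p)) ⟩
            walk (suc p + r) c        ≡⟨ walk-+ (suc p) r c ⟩
            walk r (walk (suc p) c)   ≡⟨ cong (walk r) e ⟩
            walk r c                  ∎

      OnWalk : Corner → Corner → Set
      OnWalk c d = ∃ λ i → i < 2 * len × (d ≡ walk i c ⊎ d ≡ arc (walk i c))

      side-start : ∀ c → valid c → Period c → OnWalk c (side c)
      side-start c v (suc p , _ , p≤ , e) = p , <-≤-trans (n<1+n p) p≤ , inj₂ (begin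
        side c                          ≡⟨ cong side (sym e) ⟩
        side (walk (suc p) c)           ≡⟨ cong side (walk-suc p c) ⟩
        side (side (arc (walk p c)))    ≡⟨ side-involutive (arc (walk p c)) (arc-valid (walk p c) (walk-valid p c v)) ⟩
        arc (walk p c)                  ∎)
        where open ≡-Reasoning

      side-walk : ∀ c → valid c → ∀ i → i < 2 * len → OnWalk c (side (walk i c))
      side-walk c v zero _ = side-start c v (period c v)
      side-walk c v (suc i) i< = i , <-trans (n<1+n i) i< ,
        inj₂ (trans (cong side (walk-suc i c)) (side-involutive (arc (walk i c)) (arc-valid (walk i c) (walk-valid i c v))))

      step-walk : ∀ c i → (∃ λ i′ → i′ < 2 * len × walk (suc i) c ≡ walk i′ c) → OnWalk c (step (walk i c))
      step-walk c i (i′ , i′< , e) = i′ , i′< , inj₁ (trans (sym (walk-suc i c)) e)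

      OnWalk-closed : ∀ c → valid c → Closed (OnWalk c)
      OnWalk-closed c v d vd (i , i< , inj₁ refl) = (i , i< , inj₂ refl) , side-walk c v i i<
      OnWalk-closed c v d vd (i , i< , inj₂ refl) =
        (i , i< , inj₁ (arc-involutive (walk i c) (walk-valid i c v))) , step-walk c i (walk-mod c (period c v) (suc i))

      walk-∈-iterateN : ∀ k i c → i < k → walk i c ∈ iterateN k step c
      walk-∈-iterateN (suc k) zero c _ = here refl
      walk-∈-iterateN (suc k) (suc i) c (s≤s i<) = there (walk-∈-iterateN k i (step c) i<)

      ∈-iterateN-walk : ∀ k c d → d ∈ iterateN k step c → ∃ λ i → i < k × d ≡ walk i c
      ∈-iterateN-walk (suc k) c d (here refl) = zero , s≤s z≤n , refl
      ∈-iterateN-walk (suc k) c d (there m) with ∈-iterateN-walk k (step c) d m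
      ... | i , i< , e = suc i , s≤s i< , e

      OnWalk⇒∈component : ∀ c d → OnWalk c d → d ∈ component c
      OnWalk⇒∈component c d (i , i< , inj₁ refl) = ∈-++⁺ˡ (walk-∈-iterateN (2 * len) i c i<)
      OnWalk⇒∈component c d (i , i< , inj₂ refl) = ∈-++⁺ʳ (iterateN (2 * len) step c) (∈-map⁺ arc (walk-∈-iterateN (2 * len) i c i<))

      ∈component⇒OnWalk : ∀ c d → d ∈ component c → OnWalk c d
      ∈component⇒OnWalk c d m with ∈-++⁻ (iterateN (2 * len) step c) m
      ... | inj₁ m₁ with ∈-iterateN-walk (2 * len) c d m₁
      ... | i , i< , e = i , i< , inj₁ e
      ∈component⇒OnWalk c d m | inj₂ m₂ with ∈-map⁻ arc m₂
      ... | x , mx , refl with ∈-iterateN-walk (2 * len) c x mx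
      ... | i , i< , e = i , i< , inj₂ (cong arc e)

      Conn-walk : ∀ i c → valid c → Conn c (walk i c)
      Conn-walk zero c v = done
      Conn-walk (suc i) c v = f-step v (g-step (arc-valid c v) (Conn-walk i (step c) (step-valid c v)))

      OnWalk⇒Conn : ∀ c d → valid c → OnWalk c d → Conn c d
      OnWalk⇒Conn c d v (i , _ , inj₁ refl) = Conn-walk i c v
      OnWalk⇒Conn c d v (i , _ , inj₂ refl) = Conn-trans (Conn-walk i c v) (f-step (walk-valid i c v) done)

      OnWalk-valid : ∀ c d → valid c → OnWalk c d → valid d
      OnWalk-valid c d v (i , _ , inj₁ refl) = walk-valid i c v
      OnWalk-valid c d v (i , _ , inj₂ refl) = arc-valid (walk i c) (walk-valid i c v)

      cornersAt : ℕ → List Corner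
      cornersAt p = (p , false) ∷ (p , true) ∷ []

      otherCorners : List Corner
      otherCorners = (0 , true) ∷ concatMap cornersAt (applyUpTo suc (length os))

      ∈cornersAt : ∀ p b → (p , b) ∈ cornersAt p
      ∈cornersAt p false = here refl
      ∈cornersAt p true = there (here refl)

      ∈otherCorners : ∀ c → valid c → c ≢ (0 , false) → c ∈ otherCorners
      ∈otherCorners (zero , false) v ne = ⊥-elim (ne refl)
      ∈otherCorners (zero , true) v ne = here refl
      ∈otherCorners (suc p , b) (s≤s v) ne = there (∈-concatMap⁺ cornersAt (lose (∈-applyUpTo⁺ suc v) (∈cornersAt (suc p) b)))

      otherCorners-positive : ∀ c → c ∈ otherCorners → valid c × 1 ≤ code c
      otherCorners-positive .(0 , true) (here refl) = s≤s z≤n , s≤s z≤n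
      otherCorners-positive c (there m) with find (∈-concatMap⁻ cornersAt {xs = applyUpTo suc (length os)} m)
      ... | q , mq , mc with ∈-applyUpTo⁻ suc mq
      ... | i , i< , refl = at mc
        where
          at : c ∈ cornersAt (suc i) → valid c × 1 ≤ code c
          at (here refl) = s≤s i< , subst (1 ≤_) (sym (2*-suc i 0)) (s≤s z≤n)
          at (there (here refl)) = s≤s i< , subst (1 ≤_) (sym (2*-suc i 1)) (s≤s z≤n)

      isRep-origin : isRep (0 , false) ≡ true
      isRep-origin = allB-const-true (component (0 , false))

      one-component : (∀ c → valid c → Conn c (0 , false)) → countB isRep corners ≡ 1
      one-component conn rewrite isRep-origin = cong suc (countB-all-false isRep otherCorners notRep)
        where
          notRep : ∀ c → c ∈ otherCorners → isRep c ≡ false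
          notRep c m with otherCorners-positive c m
          ... | v , c≥1 = allB-∈-false _
                            (OnWalk⇒∈component c (0 , false) (Closed-Conn (OnWalk-closed c v) (conn c v) (0 , ≤-trans (s≤s z≤n) (code< c v) , inj₁ refl)))
                            (positive≰ᵇ0 c≥1)
            where
              positive≰ᵇ0 : ∀ {x} → 1 ≤ x → (x ≤ᵇ 0) ≡ false
              positive≰ᵇ0 (s≤s _) = refl

      -- Descend along strictly smaller codes until a representative is reached.
      closed-representative : ∀ (S : Corner → Set) → Closed S → ∀ k c → code c < k → valid c → S c →
                              ∃ λ c′ → valid c′ × S c′ × isRep c′ ≡ true
      closed-representative S cl (suc k) c c<k v s with isRep c in rep
      ... | true = c , v , s , rep
      ... | false with allB-false _ (component c) rep
      ... | d , md , smaller =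
        closed-representative S cl k d (≤-trans (≰⇒> (λ le → subst T smaller (≤⇒≤ᵇ le))) (≤-pred c<k))
          (OnWalk-valid c d v (∈component⇒OnWalk c d md)) (Closed-Conn cl (OnWalk⇒Conn c d v (∈component⇒OnWalk c d md)) s)

      two-components : ∀ (S : Corner → Set) → Closed S → ∀ c → valid c → S c → ¬ S (0 , false) → 2 ≤ countB isRep corners
      two-components S cl c v s ¬s₀ with closed-representative S cl (suc (code c)) c ≤-refl v s
      ... | c′ , v′ , s′ , rep rewrite isRep-origin =
        s≤s (countB-∈-true isRep (∈otherCorners c′ v′ (λ e → ¬s₀ (subst S e s′))) rep)

  -- Spanning subgraphs

  label : SignedRotation → ℕ → ℕ
  label L p = proj₁ (nth L p)

  filterB-unique : ∀ (pr : ℕ → Bool) q xs → (∀ x → x ∈ xs → pr x ≡ true → x ≡ q) → q ∈ xs → pr q ≡ true →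
                   ∃ λ ys → filterB pr xs ≡ q ∷ ys
  filterB-unique pr q (x ∷ xs) u (here refl) e rewrite e = filterB pr xs , refl
  filterB-unique pr q (x ∷ xs) u (there m) e with pr x in ex
  ... | true with u x (here refl) ex
  ... | refl = filterB pr xs , refl
  filterB-unique pr q (x ∷ xs) u (there m) e | false = filterB-unique pr q xs (λ y my → u y (there my)) m e

  partnerPos-unique : ∀ L p q → p < length L → q < length L → q ≢ p → label L q ≡ label L p →
                      (∀ q′ → q′ < length L → q′ ≢ p → label L q′ ≡ label L p → q′ ≡ q) → Boundary.partnerPos L p ≡ q
  partnerPos-unique L p q p< q< q≢p same unique with filterB-unique isPartner q (Boundary.positions L) only-q (∈-applyUpTo⁺ _ q<) q-isPartner
    where
      isPartner : ℕ → Bool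
      isPartner q′ = not (q′ == p) ∧ (label L q′ == label L p)
      q-isPartner : isPartner q ≡ true
      q-isPartner rewrite ≢⇒== q p q≢p | ≡⇒== (label L q) (label L p) same = refl
      only-q : ∀ x → x ∈ Boundary.positions L → isPartner x ≡ true → x ≡ q
      only-q x mx e with ∈-applyUpTo⁻ _ mx | x == p in x==p
      ... | i , i< , refl | false = unique i i< (λ { refl → subst T (trans (sym (≡⇒== i i refl)) x==p) _ }) (==⇒≡ _ _ e)
  ... | ys , eq rewrite eq = refl

  record Pairing (L : SignedRotation) : Set where
    field
      mate : ℕ → ℕ
      mate< : ∀ P → P < length L → mate P < length L
      mate-involutive : ∀ P → P < length L → mate (mate P) ≡ P
      mate≢ : ∀ P → P < length L → mate P ≢ P
      mate-label : ∀ P → P < length L → label L (mate P) ≡ label L P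
      label-unique : ∀ P Q → P < length L → Q < length L → label L Q ≡ label L P → Q ≡ P ⊎ Q ≡ mate P

  module Rank (F : List Bool) where

    kept : Occ → Bool
    kept o = inSubset F (proj₁ o)

    keptAt : List Occ → ℕ → Bool
    keptAt L P = kept (nth L P)

    -- the number of kept occurrences before position P: where position P lands in restrict F L
    rank : List Occ → ℕ → ℕ
    rank _ zero = 0
    rank [] (suc _) = 0
    rank (o ∷ os) (suc P) = bit (kept o) + rank os P

    nth-restrict-rank : ∀ L P → P < length L → keptAt L P ≡ true → nth (restrict F L) (rank L P) ≡ nth L P
    nth-restrict-rank (o ∷ os) zero _ k with kept o
    nth-restrict-rank (o ∷ os) zero _ refl | true = refl
    nth-restrict-rank (o ∷ os) (suc P) (s≤s P<) k with kept o
    ... | true = nth-restrict-rank os P P< k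
    ... | false = nth-restrict-rank os P P< k

    rank-suc : ∀ L P → P < length L → rank L (suc P) ≡ rank L P + bit (keptAt L P)
    rank-suc (o ∷ os) zero _ = +-identityʳ _
    rank-suc (o ∷ os) (suc P) (s≤s P<) = trans (cong (bit (kept o) +_) (rank-suc os P P<)) (sym (+-assoc (bit (kept o)) _ _))

    rank-beyond : ∀ L P → length L ≤ P → rank L P ≡ length (restrict F L)
    rank-beyond [] zero _ = refl
    rank-beyond [] (suc P) _ = refl
    rank-beyond (o ∷ os) (suc P) (s≤s le) with kept o
    ... | true = cong suc (rank-beyond os P le)
    ... | false = rank-beyond os P le

    rank-mono : ∀ L P Q → P ≤ Q → rank L P ≤ rank L Q
    rank-mono _ zero Q _ = z≤n
    rank-mono [] (suc P) Q _ = z≤n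
    rank-mono (o ∷ os) (suc P) (suc Q) (s≤s le) = +-monoʳ-≤ (bit (kept o)) (rank-mono os P Q le)

    rank-strict : ∀ L P Q → P < length L → keptAt L P ≡ true → P < Q → rank L P < rank L Q
    rank-strict L P Q P< k P<Q = begin-strict
      rank L P                          <⟨ n<1+n _ ⟩
      suc (rank L P)                    ≡⟨ +-comm 1 _ ⟩
      rank L P + bit true               ≡⟨ cong (λ b → rank L P + bit b) (sym k) ⟩
      rank L P + bit (keptAt L P)       ≡⟨ sym (rank-suc L P P<) ⟩
      rank L (suc P)                    ≤⟨ rank-mono L (suc P) Q P<Q ⟩
      rank L Q                          ∎
      where open ≤-Reasoning

    rank<length : ∀ L P → P < length L → keptAt L P ≡ true → rank L P < length (restrict F L)
    rank<length L P P< k = subst (rank L P <_) (rank-beyond L (length L) ≤-refl) (rank-strict L P (length L) P< k P<)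

    rank-surjective : ∀ L r → r < length (restrict F L) → ∃ λ P → P < length L × keptAt L P ≡ true × rank L P ≡ r
    rank-surjective (o ∷ os) r r< with kept o in ko
    rank-surjective (o ∷ os) zero r< | true = 0 , s≤s z≤n , ko , refl
    rank-surjective (o ∷ os) (suc r) (s≤s r<) | true with rank-surjective os r r<
    ... | P , P< , k , e = suc P , s≤s P< , k , trans (cong (λ z → bit z + rank os P) ko) (cong suc e)
    rank-surjective (o ∷ os) r r< | false with rank-surjective os r r<
    ... | P , P< , k , e = suc P , s≤s P< , k , trans (cong (λ z → bit z + rank os P) ko) e

    rank-injective : ∀ L P Q → P < length L → Q < length L → keptAt L P ≡ true → keptAt L Q ≡ true → rank L P ≡ rank L Q → P ≡ Q
    rank-injective L P Q P< Q< kP kQ e with <-cmp P Q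
    ... | tri≈ _ P≡Q _ = P≡Q
    ... | tri< P<Q _ _ = ⊥-elim (<⇒≢ (rank-strict L P Q P< kP P<Q) e)
    ... | tri> _ _ Q<P = ⊥-elim (<⇒≢ (rank-strict L Q P Q< kQ Q<P) (sym e))

  module Spanning (F : List Bool) (lo : Occ) (los : List Occ) (pairing : Pairing (lo ∷ los)) where
    open Rank F
    open Pairing pairing

    L : SignedRotation
    L = lo ∷ los

    N : ℕ
    N = length L

    module U = NonEmptyBoundary lo los

    keptAt-mate : ∀ P → P < N → keptAt L (mate P) ≡ keptAt L P
    keptAt-mate P P< = cong (inSubset F) (mate-label P P<)

    twist : ℕ → Bool → Bool
    twist P b = flipIf (sameSign (U.sign P) (U.sign (mate P))) b

    twist-involutive : ∀ P b → P < N → twist (mate P) (twist P b) ≡ b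
    twist-involutive P b P< rewrite mate-involutive P P< | sameSign-comm (U.sign (mate P)) (U.sign P)
      = flipIf-involutive (sameSign (U.sign P) (U.sign (mate P))) b

    -- The side map of the spanning subgraph, drawn on the corners of L: a deleted edge end
    -- joins its own two corners.
    sideF : Corner → Corner
    sideF (P , b) = if keptAt L P then (mate P , twist P b) else (P , not b)

    sideF-kept : ∀ P b → keptAt L P ≡ true → sideF (P , b) ≡ (mate P , twist P b)
    sideF-kept P b k rewrite k = refl

    sideF-deleted : ∀ P b → keptAt L P ≡ false → sideF (P , b) ≡ (P , not b)
    sideF-deleted P b k rewrite k = refl

    sideF-valid : ∀ c → U.valid c → U.valid (sideF c)
    sideF-valid (P , b) v with keptAt L P
    ... | true = mate< P v
    ... | false = v

    sideF-involutive : ∀ c → U.valid c → sideF (sideF c) ≡ c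
    sideF-involutive (P , b) v with keptAt L P in k
    ... | true = begin
      sideF (mate P , twist P b)                       ≡⟨ sideF-kept (mate P) (twist P b) (trans (keptAt-mate P v) k) ⟩
      (mate (mate P) , twist (mate P) (twist P b))     ≡⟨ cong₂ _,_ (mate-involutive P v) (twist-involutive P b v) ⟩
      (P , b)                                          ∎
      where open ≡-Reasoning
    ... | false = trans (sideF-deleted P (not b) k) (cong (P ,_) (not-involutive b))

    module G = Reachability U.valid U.arc sideF
    module GI = G.Involutive U.arc-valid sideF-valid U.arc-involutive sideF-involutive

    G-arc : ∀ {x y} → U.valid x → U.arc x ≡ y → G.Conn x y
    G-arc v refl = G.f-step v G.done

    G-side : ∀ {x y} → U.valid x → sideF x ≡ y → G.Conn x y
    G-side v refl = G.g-step v G.done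

    arc-inside : ∀ P → suc P < N → U.arc (P , true) ≡ (suc P , false)
    arc-inside P lt rewrite ≢⇒== (suc P) N (<⇒≢ lt) = refl

    arc-last : ∀ P → suc P ≡ N → U.arc (P , true) ≡ (0 , false)
    arc-last P e rewrite ≡⇒== (suc P) N e = refl

    rank-deleted : ∀ P → P < N → keptAt L P ≡ false → rank L (suc P) ≡ rank L P
    rank-deleted P P< k = trans (rank-suc L P P<) (trans (cong (λ z → rank L P + bit z) k) (+-identityʳ _))

    rank-kept : ∀ P → P < N → keptAt L P ≡ true → rank L (suc P) ≡ suc (rank L P)
    rank-kept P P< k = trans (rank-suc L P P<) (trans (cong (λ z → rank L P + bit z) k) (+-comm (rank L P) 1))

    deleted-at : ∀ P Q → P < N → P < Q → rank L Q ≤ rank L P → keptAt L P ≡ false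
    deleted-at P Q P< P<Q le with keptAt L P in k
    ... | true = ⊥-elim (<⇒≱ (rank-strict L P Q P< k P<Q) le)
    ... | false = refl

    -- Runs of deleted edge ends are crossed by alternating arcs and (short-circuited) sides.
    skip-deleted : ∀ d P → suc P + d < N → rank L (suc P + d) ≤ rank L (suc P) → G.Conn (P , true) (suc P + d , false)
    skip-deleted zero P lt _ = subst (λ z → G.Conn (P , true) (z , false)) (sym (+-identityʳ (suc P)))
      (G-arc (<-trans (n<1+n P) lt′) (arc-inside P lt′))
      where lt′ = subst (_< N) (+-identityʳ (suc P)) lt
    skip-deleted (suc d) P lt le =
      G.Conn-trans (G-arc P< (arc-inside P sP<))
        (G.Conn-trans (G-side sP< (sideF-deleted (suc P) false deleted))
          (subst (λ z → G.Conn (suc P , true) (z , false)) (sym (+-suc (suc P) d)) (skip-deleted d (suc P) lt′ le′)))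
      where
        lt′ : suc (suc P) + d < N
        lt′ = subst (_< N) (+-suc (suc P) d) lt
        sP< : suc P < N
        sP< = ≤-trans (s≤s (s≤s (m≤m+n P d))) (<⇒≤ lt′)
        P< : P < N
        P< = <-trans (n<1+n P) sP<
        deleted : keptAt L (suc P) ≡ false
        deleted = deleted-at (suc P) (suc P + suc d) sP< (m<m+n (suc P) z<s) le
        le′ : rank L (suc (suc P) + d) ≤ rank L (suc (suc P))
        le′ = ≤-trans (≤-reflexive (cong (rank L) (sym (+-suc (suc P) d)))) (≤-trans le (rank-mono L (suc P) (suc (suc P)) (n≤1+n _)))

    to-origin : ∀ k P → suc P + k ≡ N → length (restrict F L) ≤ rank L (suc P) → G.Conn (P , true) (0 , false)
    to-origin zero P e _ = G-arc (subst (P <_) e′ (n<1+n P)) (arc-last P e′)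
      where e′ = trans (sym (+-identityʳ (suc P))) e
    to-origin (suc k) P e le =
      G.Conn-trans (G-arc P< (arc-inside P sP<))
        (G.Conn-trans (G-side sP< (sideF-deleted (suc P) false deleted))
          (to-origin k (suc P) (trans (sym (+-suc (suc P) k)) e) (≤-trans le (rank-mono L (suc P) (suc (suc P)) (n≤1+n _)))))
      where
        sP< : suc P < N
        sP< = subst (suc P <_) e (m<m+n (suc P) z<s)
        P< : P < N
        P< = <-trans (n<1+n P) sP<
        deleted : keptAt L (suc P) ≡ false
        deleted = deleted-at (suc P) N sP< sP< (≤-trans (≤-reflexive (rank-beyond L N ≤-refl)) le)

    from-origin : ∀ Q → Q < N → rank L Q ≡ 0 → G.Conn (0 , false) (Q , false)
    from-origin zero _ _ = G.done
    from-origin (suc Q) Q< e =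
      G.Conn-trans (G-side (s≤s z≤n) (sideF-deleted 0 false (deleted-at 0 (suc Q) (s≤s z≤n) (s≤s z≤n) (≤-reflexive e))))
        (skip-deleted Q 0 Q< (≤-trans (≤-reflexive e) z≤n))

    module Restricted (o : Occ) (os : List Occ) (restrict≡ : restrict F L ≡ o ∷ os) where
      module R = NonEmptyBoundary o os

      m : ℕ
      m = R.len

      rank-end : rank L N ≡ m
      rank-end = trans (rank-beyond L N ≤-refl) (cong length restrict≡)

      rank≤m : ∀ P → rank L P ≤ m
      rank≤m P with ≤-total P N
      ... | inj₁ P≤N = subst (rank L P ≤_) rank-end (rank-mono L P N P≤N)
      ... | inj₂ N≤P = ≤-reflexive (trans (rank-beyond L P N≤P) (cong length restrict≡))

      rank< : ∀ P → P < N → keptAt L P ≡ true → rank L P < m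
      rank< P P< k = subst (rank L P <_) (cong length restrict≡) (rank<length L P P< k)

      rank-onto : ∀ r → r < m → ∃ λ P → P < N × keptAt L P ≡ true × rank L P ≡ r
      rank-onto r r< = rank-surjective L r (subst (r <_) (sym (cong length restrict≡)) r<)

      nth-R : ∀ P → P < N → keptAt L P ≡ true → nth (o ∷ os) (rank L P) ≡ nth L P
      nth-R P P< k = trans (cong (λ z → nth z (rank L P)) (sym restrict≡)) (nth-restrict-rank L P P< k)

      kept-mate : ∀ P → P < N → keptAt L P ≡ true → keptAt L (mate P) ≡ true
      kept-mate P P< k = trans (keptAt-mate P P<) k

      R-partner : ∀ P → P < N → keptAt L P ≡ true → R.partnerPos (rank L P) ≡ rank L (mate P)
      R-partner P P< k =
        partnerPos-unique (o ∷ os) (rank L P) (rank L (mate P)) (rank< P P< k) (rank< (mate P) mate<P k′) distinct same-label only-mate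
        where
          mate<P = mate< P P<
          k′ = kept-mate P P< k
          label-R : ∀ Q → Q < N → keptAt L Q ≡ true → label (o ∷ os) (rank L Q) ≡ label L Q
          label-R Q Q< kQ = cong proj₁ (nth-R Q Q< kQ)
          distinct : rank L (mate P) ≢ rank L P
          distinct e = mate≢ P P< (rank-injective L (mate P) P mate<P P< k′ k e)
          same-label : label (o ∷ os) (rank L (mate P)) ≡ label (o ∷ os) (rank L P)
          same-label = trans (label-R (mate P) mate<P k′) (trans (mate-label P P<) (sym (label-R P P< k)))
          only-mate : ∀ q → q < m → q ≢ rank L P → label (o ∷ os) q ≡ label (o ∷ os) (rank L P) → q ≡ rank L (mate P)
          only-mate q q< q≢ e with rank-onto q q<
          ... | Q , Q< , kQ , refl with label-unique P Q P< Q< (trans (sym (label-R Q Q< kQ)) (trans e (label-R P P< k)))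
          ... | inj₁ refl = ⊥-elim (q≢ refl)
          ... | inj₂ refl = refl

      R-partner< : ∀ r → r < m → R.partnerPos r < m
      R-partner< r r< with rank-onto r r<
      ... | P , P< , k , refl rewrite R-partner P P< k = rank< (mate P) (mate< P P<) (kept-mate P P< k)

      R-partner-involutive : ∀ r → r < m → R.partnerPos (R.partnerPos r) ≡ r
      R-partner-involutive r r< with rank-onto r r<
      ... | P , P< , k , refl rewrite R-partner P P< k | R-partner (mate P) (mate< P P<) (kept-mate P P< k) | mate-involutive P P< = refl

      module RP = R.Paired R-partner< R-partner-involutive

      R-side≡ : ∀ P b → P < N → keptAt L P ≡ true → R.side (rank L P , b) ≡ (rank L (mate P) , twist P b)
      R-side≡ P b P< k = trans (R.side≡ (rank L P) b)
        (cong₂ _,_ (R-partner P P< k) (cong (λ z → flipIf z b)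
          (cong₂ sameSign (sign-R P P< k) (trans (cong R.sign (R-partner P P< k)) (sign-R (mate P) (mate< P P<) (kept-mate P P< k))))))
        where
          sign-R : ∀ Q → Q < N → keptAt L Q ≡ true → R.sign (rank L Q) ≡ U.sign Q
          sign-R Q Q< kQ = cong proj₂ (nth-R Q Q< kQ)

      wrap : ℕ → ℕ
      wrap r = if r == m then 0 else r

      wrap-< : ∀ r → r < m → wrap r ≡ r
      wrap-< r r< rewrite ≢⇒== r m (<⇒≢ r<) = refl

      wrap-m : wrap m ≡ 0
      wrap-m rewrite ≡⇒== m m refl = refl

      wrap-valid : ∀ r → r ≤ m → wrap r < m
      wrap-valid r r≤ with m≤n⇒m<n∨m≡n r≤
      ... | inj₁ r< = subst (_< m) (sym (wrap-< r r<)) r<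
      ... | inj₂ refl = subst (_< m) (sym wrap-m) (s≤s z≤n)

      -- A deleted edge end is collapsed onto the start corner of the next kept end.
      project : Corner → Corner
      project (P , b) = if keptAt L P then (rank L P , b) else (wrap (rank L P) , false)

      project-kept : ∀ P b → keptAt L P ≡ true → project (P , b) ≡ (rank L P , b)
      project-kept P b k rewrite k = refl

      project-deleted : ∀ P b → keptAt L P ≡ false → project (P , b) ≡ (wrap (rank L P) , false)
      project-deleted P b k rewrite k = refl

      project-origin : project (0 , false) ≡ (0 , false)
      project-origin with keptAt L 0
      ... | true = refl
      ... | false = refl

      project-valid : ∀ c → U.valid c → R.valid (project c)
      project-valid (P , b) v with keptAt L P in k
      ... | true = rank< P v k
      ... | false = wrap-valid (rank L P) (rank≤m P)

      project-start : ∀ Q → Q < N → project (Q , false) ≡ (wrap (rank L Q) , false)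
      project-start Q Q< with keptAt L Q in k
      ... | true = cong (_, false) (sym (wrap-< (rank L Q) (rank< Q Q< k)))
      ... | false = refl

      project-arc-end : ∀ P → P < N → project (U.arc (P , true)) ≡ (wrap (rank L (suc P)) , false)
      project-arc-end P P< with m≤n⇒m<n∨m≡n P<
      ... | inj₁ sP<N = trans (cong project (arc-inside P sP<N)) (project-start (suc P) sP<N)
      ... | inj₂ sP≡N = begin
        project (U.arc (P , true))   ≡⟨ cong project (arc-last P sP≡N) ⟩
        project (0 , false)          ≡⟨ project-origin ⟩
        (0 , false)                  ≡⟨ cong (_, false) (sym wrap-m) ⟩
        (wrap m , false)             ≡⟨ cong (λ z → (wrap z , false)) (sym (trans (cong (rank L) sP≡N) rank-end)) ⟩
        (wrap (rank L (suc P)) , false) ∎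
        where open ≡-Reasoning

      R-arc-end : ∀ P → P < N → R.Conn (project (P , true)) (wrap (rank L (suc P)) , false)
      R-arc-end P P< with keptAt L P in k
      ... | true = subst (λ z → R.Conn (rank L P , true) (wrap z , false)) (sym (rank-kept P P< k)) (R.f-step (rank< P P< k) R.done)
      ... | false = subst (λ z → R.Conn (wrap (rank L P) , false) (wrap z , false)) (sym (rank-deleted P P< k)) R.done

      project-arc-true : ∀ P → P < N → R.Conn (project (P , true)) (project (U.arc (P , true)))
      project-arc-true P P< = subst (R.Conn (project (P , true))) (sym (project-arc-end P P<)) (R-arc-end P P<)

      project-arc-false : ∀ P → P < N → R.Conn (project (P , false)) (project (U.arc (P , false)))
      project-arc-false P P< = RP.Conn-sym (project-valid (U.arc (P , false)) prev<)
        (subst (λ z → R.Conn (project (U.arc (P , false))) (project z)) (U.arc-involutive (P , false) P<) (project-arc-true (U.prevPos P) prev<))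
        where prev< = U.arc-valid (P , false) P<

      project-side : ∀ P b → P < N → R.Conn (project (P , b)) (project (sideF (P , b)))
      project-side P b P< with keptAt L P in k
      ... | true = R.g-step (rank< P P< k)
        (subst (R.Conn (R.side (rank L P , b))) (trans (R-side≡ P b P< k) (sym (project-kept (mate P) (twist P b) (kept-mate P P< k)))) R.done)
      ... | false = subst (R.Conn (wrap (rank L P) , false)) (sym (project-deleted P (not b) k)) R.done

      transport : ∀ {x y} → G.Conn x y → U.valid x → R.Conn (project x) (project y)
      transport G.done v = R.done
      transport {P , true} (G.f-step _ c) v = R.Conn-trans (project-arc-true P v) (transport c (U.arc-valid (P , true) v))
      transport {P , false} (G.f-step _ c) v = R.Conn-trans (project-arc-false P v) (transport c (U.arc-valid (P , false) v))
      transport {P , b} (G.g-step _ c) v = R.Conn-trans (project-side P b v) (transport c (sideF-valid (P , b) v))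

      one-component : (∀ c → U.valid c → G.Conn c (0 , false)) → countB R.isRep R.corners ≡ 1
      one-component conn = RP.one-component R-conn
        where
          R-conn : ∀ u → R.valid u → R.Conn u (0 , false)
          R-conn (r , b) r< with rank-onto r r<
          ... | P , P< , k , refl = subst₂ R.Conn (project-kept P b k) project-origin (transport (conn (P , b) P<) P<)

      next-kept : ∀ P → P < N → keptAt L P ≡ true →
                  ∃ λ P′ → P′ < N × keptAt L P′ ≡ true × rank L P′ ≡ wrap (suc (rank L P)) × G.Conn (P , true) (P′ , false)
      next-kept P P< k with m≤n⇒m<n∨m≡n (rank< P P< k)
      ... | inj₁ lt with rank-onto (suc (rank L P)) lt
      ...   | P′ , P′< , k′ , e′ = P′ , P′< , k′ , trans e′ (sym (wrap-< _ lt)) ,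
                subst (λ z → G.Conn (P , true) (z , false)) (m+[n∸m]≡n P<P′)
                  (skip-deleted (P′ ∸ suc P) P (subst (_< N) (sym (m+[n∸m]≡n P<P′)) P′<)
                    (≤-reflexive (trans (cong (rank L) (m+[n∸m]≡n P<P′)) (trans e′ (sym (rank-kept P P< k))))))
        where
          P<P′ : P < P′
          P<P′ = ≰⇒> (λ P′≤P → <⇒≱ (subst (rank L P <_) (sym e′) (n<1+n _)) (rank-mono L P′ P P′≤P))
      next-kept P P< k | inj₂ eq with rank-onto 0 (s≤s z≤n)
      ...   | P′ , P′< , k′ , e′ = P′ , P′< , k′ , trans e′ (sym (trans (cong wrap eq) wrap-m)) ,
                G.Conn-trans (to-origin (N ∸ suc P) P (m+[n∸m]≡n P<) (≤-reflexive (trans (cong length restrict≡) (sym (trans (rank-kept P P< k) eq))))) (from-origin P′ P′< e′)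

      two-components : ∀ (S : Corner → Set) → G.Closed S → ∀ P b → P < N → keptAt L P ≡ true → S (P , b) → ¬ S (0 , false) →
                       2 ≤ countB R.isRep R.corners
      two-components S cl P₀ b₀ P₀< k₀ s₀ ¬s = RP.two-components SR SR-closed (rank L P₀ , b₀) (rank< P₀ P₀< k₀) (P₀ , P₀< , k₀ , refl , s₀) ¬SR-origin
        where
          SR : Corner → Set
          SR u = ∃ λ P → P < N × keptAt L P ≡ true × rank L P ≡ proj₁ u × S (P , proj₂ u)

          ¬SR-origin : ¬ SR (0 , false)
          ¬SR-origin (P , P< , k , e , s) = ¬s (G.Closed-Conn cl (GI.Conn-sym (s≤s z≤n) (from-origin P P< e)) s)

          arc-closed : ∀ r b → SR (r , b) → SR (R.arc (r , b))
          arc-closed r true (P , P< , k , refl , s) with next-kept P P< k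
          ... | P′ , P′< , k′ , e′ , c = P′ , P′< , k′ , e′ , G.Closed-Conn cl c s
          arc-closed r false (P , P< , k , refl , s) with rank-onto (R.prevPos (rank L P)) (R.arc-valid (rank L P , false) (rank< P P< k))
          ... | P″ , P″< , k″ , e″ with next-kept P″ P″< k″
          ...   | P‴ , P‴< , k‴ , e‴ , c = P″ , P″< , k″ , e″ , G.Closed-Conn cl (GI.Conn-sym P″< (subst (λ z → G.Conn (P″ , true) (z , false)) P‴≡P c)) s
            where
              P‴≡P : P‴ ≡ P
              P‴≡P = rank-injective L P‴ P P‴< P< k‴ k
                (trans e‴ (trans (cong (λ z → wrap (suc z)) e″) (cong proj₁ (R.arc-involutive (rank L P , false) (rank< P P< k)))))

          side-closed : ∀ r b → SR (r , b) → SR (R.side (r , b))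
          side-closed r b (P , P< , k , refl , s) rewrite R-side≡ P b P< k =
            mate P , mate< P P< , kept-mate P P< k , refl , subst S (sideF-kept P b k) (proj₂ (cl (P , b) P< s))

          SR-closed : R.Closed SR
          SR-closed (r , b) _ s = arc-closed r b s , side-closed r b s

module W¹QuasiTrees where

  open Boundaries
  open import Defs
  open import Data.Nat using (ℕ; zero; suc; _+_; _*_; _≤_; _<_; _<ᵇ_; z≤n; s≤s)
  import Data.Nat as ℕ
  open import Data.Nat.Properties
  open import Data.Nat.Tactic.RingSolver using (solve-∀)
  open import Data.Bool using (Bool; true; false; if_then_else_; not; _∧_; _∨_; T)
  open import Data.Bool.Properties using (T-∧; T-∨; T-≡)
  import Data.Bool.Properties as Bool
  open import Data.List using (List; []; _∷_; length; concatMap; applyUpTo; map; _++_)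
  open import Data.List.Properties using (length-applyUpTo)
  open import Data.List.Membership.Propositional using (_∈_)
  open import Data.List.Membership.Propositional.Properties using (∈-++⁻; ∈-map⁻)
  open import Data.List.Relation.Unary.Any using (here; there)
  open import Data.Maybe using (Maybe; just; nothing; maybe; _>>=_)
  open import Data.Product using (_×_; _,_; proj₁; proj₂; ∃; Σ)
  open import Data.Sum using (_⊎_; inj₁; inj₂)
  open import Data.Empty using (⊥; ⊥-elim)
  open import Data.Unit using (tt)
  open import Function.Bundles using (Equivalence)
  open import Level using (Lift; lift) renaming (suc to lsuc; zero to lzero)
  open import Relation.Binary.PropositionalEquality
  open import Relation.Binary.Definitions using (DecidableEquality)
  open import Relation.Nullary using (¬_)
  open import Relation.Nullary.Decidable using (⌊_⌋; map′; toWitness; fromWitness)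

  -- The chord diagram of W¹ₙ

  double : ℕ → ℕ
  double zero = 0
  double (suc j) = suc (suc (double j))

  data Parity : ℕ → Set where
    even : ∀ j → Parity (double j)
    odd : ∀ j → Parity (suc (double j))

  parity : ∀ P → Parity P
  parity zero = even 0
  parity (suc zero) = odd 0
  parity (suc (suc P)) with parity P
  ... | even j = even (suc j)
  ... | odd j = odd (suc j)

  parity-even : ∀ j → parity (double j) ≡ even j
  parity-even zero = refl
  parity-even (suc j) rewrite parity-even j = refl

  parity-odd : ∀ j → parity (suc (double j)) ≡ odd j
  parity-odd zero = refl
  parity-odd (suc j) rewrite parity-odd j = refl

  double≢odd : ∀ i j → double i ≢ suc (double j)
  double≢odd (suc i) (suc j) e = double≢odd i j (suc-injective (suc-injective e))
  double≢odd (suc zero) zero ()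
  double≢odd (suc (suc i)) zero ()

  double-mono-< : ∀ i j → i < j → double i < double j
  double-mono-< zero (suc j) _ = s≤s z≤n
  double-mono-< (suc i) (suc j) (s≤s lt) = s≤s (s≤s (double-mono-< i j lt))

  double-mono-≤ : ∀ i j → i ≤ j → double i ≤ double j
  double-mono-≤ zero j _ = z≤n
  double-mono-≤ (suc i) (suc j) (s≤s lt) = s≤s (s≤s (double-mono-≤ i j lt))

  double-<-reflect : ∀ i j → double i < double j → i < j
  double-<-reflect zero (suc j) _ = s≤s z≤n
  double-<-reflect (suc i) (suc j) (s≤s (s≤s lt)) = s≤s (double-<-reflect i j lt)

  odd-<-reflect : ∀ i j → suc (double i) < double j → i < j
  odd-<-reflect zero (suc j) _ = s≤s z≤n
  odd-<-reflect (suc i) (suc j) (s≤s (s≤s lt)) = s≤s (odd-<-reflect i j lt)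

  tailPair : ℕ → List Occ
  tailPair i = (i + 2 , true) ∷ (i + 1 , true) ∷ []

  nth-tail-even : ∀ (f : ℕ → ℕ) K i → i < K → nth (concatMap tailPair (applyUpTo f K)) (double i) ≡ (f i + 2 , true)
  nth-tail-even f (suc K) zero _ = refl
  nth-tail-even f (suc K) (suc i) (s≤s lt) = nth-tail-even (λ x → f (suc x)) K i lt

  nth-tail-odd : ∀ (f : ℕ → ℕ) K i → i < K → nth (concatMap tailPair (applyUpTo f K)) (suc (double i)) ≡ (f i + 1 , true)
  nth-tail-odd f (suc K) zero _ = refl
  nth-tail-odd f (suc K) (suc i) (s≤s lt) = nth-tail-odd (λ x → f (suc x)) K i lt

  length-tail : ∀ xs → length (concatMap tailPair xs) ≡ double (length xs)
  length-tail [] = refl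
  length-tail (x ∷ xs) = cong (λ z → suc (suc z)) (length-tail xs)

  -- Positions 2j and 2j+1 of the rotation of W¹ (3 + k) form block j; the chord of edge j+1 joins
  -- positions 2j and 2j+3 (indices mod 2n), and last = n - 1 is the index of the last block.
  module W¹Geometry (k : ℕ) where

    n : ℕ
    n = suc (suc (suc k))

    last : ℕ
    last = suc (suc k)

    L : SignedRotation
    L = W¹ n

    length-W¹ : length L ≡ double n
    length-W¹ = cong (λ z → suc (suc z)) (trans (length-tail (applyUpTo (λ x → x) last)) (cong double (length-applyUpTo (λ x → x) last)))

    W¹-even : ∀ j → j < last → nth L (double (suc j)) ≡ (suc (suc j) , true)
    W¹-even j lt = trans (nth-tail-even (λ x → x) last j lt) (cong (_, true) (+-comm j 2))

    W¹-odd : ∀ j → j < last → nth L (suc (double (suc j))) ≡ (suc j , true)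
    W¹-odd j lt = trans (nth-tail-odd (λ x → x) last j lt) (cong (_, true) (+-comm j 1))

    label-even : ∀ j → j < n → label L (double j) ≡ suc j
    label-even zero _ = refl
    label-even (suc j) (s≤s lt) = cong proj₁ (W¹-even j lt)

    label-odd : ∀ j → suc j < n → label L (suc (double (suc j))) ≡ suc j
    label-odd j (s≤s lt) = cong proj₁ (W¹-odd j lt)

    sign-even : ∀ j → suc j < n → proj₂ (nth L (double (suc j))) ≡ true
    sign-even j (s≤s lt) = cong proj₂ (W¹-even j lt)

    sign-odd : ∀ j → suc j < n → proj₂ (nth L (suc (double (suc j)))) ≡ true
    sign-odd j (s≤s lt) = cong proj₂ (W¹-odd j lt)

    even< : ∀ j → double j < length L → j < n
    even< j lt = double-<-reflect j n (subst (double j <_) length-W¹ lt)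

    odd< : ∀ j → suc (double j) < length L → j < n
    odd< j lt = odd-<-reflect j n (subst (suc (double j) <_) length-W¹ lt)

    <even : ∀ j → j < n → double j < length L
    <even j lt = subst (double j <_) (sym length-W¹) (double-mono-< j n lt)

    <odd : ∀ j → j < n → suc (double j) < length L
    <odd j lt = subst (suc (double j) <_) (sym length-W¹) (double-mono-≤ (suc j) n lt)

    mateEven : ℕ → ℕ
    mateEven j = if suc j == n then 1 else suc (double (suc j))

    mateOdd : ℕ → ℕ
    mateOdd zero = double last
    mateOdd (suc j) = double j

    mateOf : ∀ P → Parity P → ℕ
    mateOf .(double j) (even j) = mateEven j
    mateOf .(suc (double j)) (odd j) = mateOdd j

    mate : ℕ → ℕ
    mate P = mateOf P (parity P)

    mate-even : ∀ j → mate (double j) ≡ mateEven j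
    mate-even j rewrite parity-even j = refl

    mate-odd : ∀ j → mate (suc (double j)) ≡ mateOdd j
    mate-odd j rewrite parity-odd j = refl

    mateEven-inner : ∀ j → suc j < n → mateEven j ≡ suc (double (suc j))
    mateEven-inner j lt rewrite ≢⇒== (suc j) n (<⇒≢ lt) = refl

    mateEven-last : mateEven last ≡ 1
    mateEven-last rewrite ≡⇒== n n refl = refl

    inner-or-last : ∀ j → j < n → suc j < n ⊎ j ≡ last
    inner-or-last j lt with m≤n⇒m<n∨m≡n lt
    ... | inj₁ lt′ = inj₁ lt′
    ... | inj₂ e = inj₂ (suc-injective e)

    mate< : ∀ P → P < length L → mate P < length L
    mate< P P< with parity P
    ... | even j with inner-or-last j (even< j P<)
    ...   | inj₁ lt rewrite mateEven-inner j lt = <odd (suc j) lt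
    ...   | inj₂ refl rewrite mateEven-last = <odd 0 (s≤s z≤n)
    mate< P P< | odd zero rewrite mate-odd zero = <even last ≤-refl
    mate< P P< | odd (suc j) = <even j (<-trans (n<1+n j) (odd< (suc j) P<))

    mate-involutive : ∀ P → P < length L → mate (mate P) ≡ P
    mate-involutive P P< with parity P
    ... | even j with inner-or-last j (even< j P<)
    ...   | inj₁ lt rewrite mateEven-inner j lt | mate-odd (suc j) = refl
    ...   | inj₂ refl rewrite mateEven-last | mate-odd zero = refl
    mate-involutive P P< | odd zero rewrite mate-odd zero | mate-even last | mateEven-last = refl
    mate-involutive P P< | odd (suc j) rewrite mate-even j | mateEven-inner j (odd< (suc j) P<) = refl

    mate≢ : ∀ P → P < length L → mate P ≢ P
    mate≢ P P< with parity P
    ... | even j with inner-or-last j (even< j P<)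
    ...   | inj₁ lt rewrite mateEven-inner j lt = λ e → double≢odd j (suc j) (sym e)
    ...   | inj₂ refl rewrite mateEven-last = λ e → double≢odd last 0 (sym e)
    mate≢ P P< | odd zero rewrite mate-odd zero = λ e → double≢odd last 0 e
    mate≢ P P< | odd (suc j) = λ e → double≢odd j (suc j) e

    mate-label : ∀ P → P < length L → label L (mate P) ≡ label L P
    mate-label P P< with parity P
    ... | even j with inner-or-last j (even< j P<)
    ...   | inj₁ lt rewrite mateEven-inner j lt | label-odd j lt = sym (label-even j (even< j P<))
    ...   | inj₂ refl rewrite mateEven-last = sym (label-even last ≤-refl)
    mate-label P P< | odd zero rewrite mate-odd zero = label-even last ≤-refl
    mate-label P P< | odd (suc j) rewrite label-odd j (odd< (suc j) P<) = label-even j (<-trans (n<1+n j) (odd< (suc j) P<))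

    label-unique : ∀ P Q → P < length L → Q < length L → label L Q ≡ label L P → Q ≡ P ⊎ Q ≡ mate P
    label-unique P Q P< Q< e with parity P | parity Q
    ... | even i | even j = inj₁ (cong double (suc-injective (trans (sym (label-even j (even< j Q<))) (trans e (label-even i (even< i P<))))))
    ... | even i | odd zero = inj₂ (sym (subst (λ z → mateEven z ≡ 1) i≡last mateEven-last))
      where i≡last = suc-injective (sym (trans (sym (label-even i (even< i P<))) (sym e)))
    ... | even i | odd (suc j) = inj₂ (sym (trans (mateEven-inner i (subst (_< n) ij (odd< (suc j) Q<)))
                                    (cong (λ z → suc (double (suc z))) (sym (suc-injective ij)))))
      where ij = trans (sym (label-odd j (odd< (suc j) Q<))) (trans e (label-even i (even< i P<)))
    ... | odd zero | even j = inj₂ (cong double (suc-injective (trans (sym (label-even j (even< j Q<))) e)))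
    ... | odd zero | odd zero = inj₁ refl
    ... | odd zero | odd (suc j) = ⊥-elim (<⇒≢ (odd< (suc j) Q<) (trans (sym (label-odd j (odd< (suc j) Q<))) e))
    ... | odd (suc i) | even j = inj₂ (cong double (suc-injective (trans (sym (label-even j (even< j Q<))) (trans e (label-odd i (odd< (suc i) P<))))))
    ... | odd (suc i) | odd zero = ⊥-elim (<⇒≢ (odd< (suc i) P<) (sym (trans e (label-odd i (odd< (suc i) P<)))))
    ... | odd (suc i) | odd (suc j) = inj₁ (cong (λ z → suc (double z)) (trans (sym (label-odd j (odd< (suc j) Q<))) (trans e (label-odd i (odd< (suc i) P<)))))

    chords : Pairing L
    chords = record { mate = mate ; mate< = mate< ; mate-involutive = mate-involutive ; mate≢ = mate≢
                     ; mate-label = mate-label ; label-unique = label-unique }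

  module W¹Spanning (k : ℕ) (F : List Bool) where
    open W¹Geometry k public
    open Rank F public
    open Spanning F (1 , false) ((n , true) ∷ wTail n) chords public hiding (L)

    inF : ℕ → Bool
    inF i = inSubset F (suc i)

    corner : ℕ → Bool → Bool → Corner
    corner j false b = (double j , b)
    corner j true b = (suc (double j) , b)

    kept-even : ∀ j → j < n → keptAt L (double j) ≡ inF j
    kept-even j lt = cong (inSubset F) (label-even j lt)

    kept-odd : ∀ j → suc j < n → keptAt L (suc (double (suc j))) ≡ inF j
    kept-odd j lt = cong (inSubset F) (label-odd j lt)

    arc-within : ∀ j → U.arc (corner j false true) ≡ corner j true false
    arc-within j rewrite ≢⇒== (suc (double j)) N (λ e → double≢odd n j (trans (sym length-W¹) (sym e))) = refl

    arc-between : ∀ j → suc j < n → U.arc (corner j true true) ≡ corner (suc j) false false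
    arc-between j lt = arc-inside (suc (double j)) (<even (suc j) lt)

    arc-around : U.arc (corner last true true) ≡ corner 0 false false
    arc-around = arc-last (suc (double last)) (sym length-W¹)

    arc-back-around : U.arc (corner 0 false false) ≡ corner last true true
    arc-back-around = cong (λ z → (Data.Nat._∸_ z 1 , true)) length-W¹

    sign-last : U.sign (double last) ≡ true
    sign-last = sign-even (suc k) ≤-refl

    side-first : ∀ b → inF 0 ≡ true → sideF (corner 0 false b) ≡ corner 1 true b
    side-first b e = sideF-kept 0 b e

    side-first⁻¹ : ∀ b → inF 0 ≡ true → sideF (corner 1 true b) ≡ corner 0 false b
    side-first⁻¹ b e = sideF-kept 3 b e

    side-next : ∀ j b → suc (suc j) < n → inF (suc j) ≡ true → sideF (corner (suc j) false b) ≡ corner (suc (suc j)) true (not b)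
    side-next j b lt e = begin
      sideF (double (suc j) , b)                           ≡⟨ sideF-kept _ b (trans (kept-even (suc j) (<-trans (n<1+n _) lt)) e) ⟩
      (mate (double (suc j)) , twist (double (suc j)) b)   ≡⟨ cong₂ _,_ (trans (mate-even (suc j)) (mateEven-inner (suc j) lt))
                                                                 (cong (λ x → flipIf x b) (cong₂ sameSign (sign-even j (<-trans (n<1+n _) lt)) signs)) ⟩
      corner (suc (suc j)) true (not b)                    ∎
      where
        open ≡-Reasoning
        signs : U.sign (mate (double (suc j))) ≡ true
        signs = trans (cong U.sign (trans (mate-even (suc j)) (mateEven-inner (suc j) lt))) (sign-odd (suc j) lt)

    side-prev : ∀ j b → suc (suc j) < n → inF (suc j) ≡ true → sideF (corner (suc (suc j)) true b) ≡ corner (suc j) false (not b)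
    side-prev j b lt e = trans (sideF-kept _ b (trans (kept-odd (suc j) lt) e))
      (cong₂ _,_ (mate-odd (suc (suc j)))
        (cong (λ x → flipIf x b) (cong₂ sameSign (sign-odd (suc j) lt) (trans (cong U.sign (mate-odd (suc (suc j)))) (sign-even j (<-trans (n<1+n _) lt))))))

    side-wrap : ∀ b → inF last ≡ true → sideF (corner last false b) ≡ corner 0 true (not b)
    side-wrap b e = trans (sideF-kept _ b (trans (kept-even last ≤-refl) e))
      (cong₂ _,_ mate-last (cong (λ x → flipIf x b) (cong₂ sameSign sign-last (cong U.sign mate-last))))
      where
        mate-last : mate (double last) ≡ 1
        mate-last = trans (mate-even last) mateEven-last

    side-wrap⁻¹ : ∀ b → inF last ≡ true → sideF (corner 0 true b) ≡ corner last false (not b)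
    side-wrap⁻¹ b e = trans (sideF-kept 1 b e)
      (cong (corner last false) (cong (λ x → flipIf x b) (cong (sameSign true) sign-last)))

  -- Transfer matrix: finite data and Boolean checks

  -- Ends of the paths that cross the cut after block s of the transfer matrix:
  --   next         the end corner of block s, whose arc leads into block s + 1,
  --   fwd₀, fwd₁   the corners of position 2s, whose edge s + 1 leads into block s + 1,
  --   wrap₀, wrap₁ the corners of position 1, whose edge n leads to the last block,
  --   origin       the corner (0 , false), whose arc leads to the last block.
  data Terminal : Set where
    next fwd₀ fwd₁ wrap₀ wrap₁ origin : Terminal

  -- The corners of block s + 1: e for its even position, o for its odd one, index = corner bit.
  data NewCorner : Set where
    e₀ e₁ o₀ o₁ : NewCorner

  data Vertex : Set where
    old : Terminal → Vertex
    new : NewCorner → Vertex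

  data Dir : Set where
    viaArc viaSide : Dir

  -- Where a move from a vertex of the step graph lands: back in blocks 0 … s, beyond block s + 1,
  -- or on a vertex.
  data Target : Set where
    inside outside : Target
    to : Vertex → Target

  terminals : List Terminal
  terminals = next ∷ fwd₀ ∷ fwd₁ ∷ wrap₀ ∷ wrap₁ ∷ origin ∷ []

  vertices : List Vertex
  vertices = old next ∷ old fwd₀ ∷ old fwd₁ ∷ old wrap₀ ∷ old wrap₁ ∷ old origin ∷ new e₀ ∷ new e₁ ∷ new o₀ ∷ new o₁ ∷ []

  dirs : List Dir
  dirs = viaArc ∷ viaSide ∷ []

  ∈terminals : ∀ t → t ∈ terminals
  ∈terminals next = here refl
  ∈terminals fwd₀ = there (here refl)
  ∈terminals fwd₁ = there (there (here refl))
  ∈terminals wrap₀ = there (there (there (here refl)))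
  ∈terminals wrap₁ = there (there (there (there (here refl))))
  ∈terminals origin = there (there (there (there (there (here refl)))))

  ∈vertices : ∀ v → v ∈ vertices
  ∈vertices (old next) = here refl
  ∈vertices (old fwd₀) = there (here refl)
  ∈vertices (old fwd₁) = there (there (here refl))
  ∈vertices (old wrap₀) = there (there (there (here refl)))
  ∈vertices (old wrap₁) = there (there (there (there (here refl))))
  ∈vertices (old origin) = there (there (there (there (there (here refl)))))
  ∈vertices (new e₀) = there (there (there (there (there (there (here refl))))))
  ∈vertices (new e₁) = there (there (there (there (there (there (there (here refl)))))))
  ∈vertices (new o₀) = there (there (there (there (there (there (there (there (here refl))))))))
  ∈vertices (new o₁) = there (there (there (there (there (there (there (there (there (here refl)))))))))

  ∈dirs : ∀ d → d ∈ dirs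
  ∈dirs viaArc = here refl
  ∈dirs viaSide = there (here refl)

  vertexCode : Vertex → ℕ
  vertexCode (old next) = 0
  vertexCode (old fwd₀) = 1
  vertexCode (old fwd₁) = 2
  vertexCode (old wrap₀) = 3
  vertexCode (old wrap₁) = 4
  vertexCode (old origin) = 5
  vertexCode (new e₀) = 6
  vertexCode (new e₁) = 7
  vertexCode (new o₀) = 8
  vertexCode (new o₁) = 9

  vertexCode-injective : ∀ v w → vertexCode v ≡ vertexCode w → v ≡ w
  vertexCode-injective v w e = trans (sym (decode-code v)) (trans (cong decode e) (decode-code w))
    where
      decode : ℕ → Vertex
      decode 0 = old next
      decode 1 = old fwd₀
      decode 2 = old fwd₁
      decode 3 = old wrap₀
      decode 4 = old wrap₁
      decode 5 = old origin
      decode 6 = new e₀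
      decode 7 = new e₁
      decode 8 = new o₀
      decode _ = new o₁
      decode-code : ∀ v → decode (vertexCode v) ≡ v
      decode-code (old next) = refl
      decode-code (old fwd₀) = refl
      decode-code (old fwd₁) = refl
      decode-code (old wrap₀) = refl
      decode-code (old wrap₁) = refl
      decode-code (old origin) = refl
      decode-code (new e₀) = refl
      decode-code (new e₁) = refl
      decode-code (new o₀) = refl
      decode-code (new o₁) = refl

  _≟ᵛ_ : DecidableEquality Vertex
  v ≟ᵛ w = map′ (vertexCode-injective v w) (cong vertexCode) (vertexCode v ℕ.≟ vertexCode w)

  _≟ᵗ_ : DecidableEquality Terminal
  t ≟ᵗ u = map′ old-injective (cong old) (old t ≟ᵛ old u)
    where
      old-injective : old t ≡ old u → t ≡ u
      old-injective refl = refl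

  _⇒ᵇ_ : Bool → Bool → Bool
  false ⇒ᵇ _ = true
  true ⇒ᵇ b = b

  modus-ponens : ∀ {a b} → T (a ⇒ᵇ b) → T a → T b
  modus-ponens {true} p _ = p

  T-∧ˡ : ∀ {a b} → T (a ∧ b) → T a
  T-∧ˡ p = proj₁ (Equivalence.to T-∧ p)

  T-∧ʳ : ∀ {a b} → T (a ∧ b) → T b
  T-∧ʳ p = proj₂ (Equivalence.to T-∧ p)

  T-∨⁻ : ∀ {a b} → T (a ∨ b) → T a ⊎ T b
  T-∨⁻ = Equivalence.to T-∨

  anyB : {A : Set} → (A → Bool) → List A → Bool
  anyB p [] = false
  anyB p (x ∷ xs) = p x ∨ anyB p xs

  anyB-witness : ∀ {A : Set} (p : A → Bool) xs → T (anyB p xs) → ∃ λ x → T (p x)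
  anyB-witness p (x ∷ xs) h with T-∨⁻ {p x} h
  ... | inj₁ px = x , px
  ... | inj₂ rest = anyB-witness p xs rest

  allB-elim : ∀ {A : Set} (p : A → Bool) {xs x} → T (allB p xs) → x ∈ xs → T (p x)
  allB-elim p {_ ∷ _} h (here refl) = T-∧ˡ h
  allB-elim p {y ∷ _} h (there m) = allB-elim p (T-∧ʳ {p y} h) m

  ∀ᵗ : (Terminal → Bool) → Bool
  ∀ᵗ p = allB p terminals

  ∀ᵛ : (Vertex → Bool) → Bool
  ∀ᵛ p = allB p vertices

  ∀ᵈ : (Dir → Bool) → Bool
  ∀ᵈ p = allB p dirs

  ∀ᵗ-elim : ∀ p → T (∀ᵗ p) → ∀ t → T (p t)
  ∀ᵗ-elim p h t = allB-elim p h (∈terminals t)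

  ∀ᵛ-elim : ∀ p → T (∀ᵛ p) → ∀ v → T (p v)
  ∀ᵛ-elim p h v = allB-elim p h (∈vertices v)

  ∀ᵈ-elim : ∀ p → T (∀ᵈ p) → ∀ d → T (p d)
  ∀ᵈ-elim p h d = allB-elim p h (∈dirs d)

  isTo : Vertex → Target → Bool
  isTo w (to v) = ⌊ v ≟ᵛ w ⌋
  isTo w _ = false

  isTo-sound : ∀ w o → T (isTo w o) → o ≡ to w
  isTo-sound w (to v) h = cong to (toWitness h)

  isOutside : Target → Bool
  isOutside outside = true
  isOutside _ = false

  isInside : Target → Bool
  isInside inside = true
  isInside _ = false

  present : Bool → Bool → Terminal → Bool
  present pK pN next = true
  present pK pN fwd₀ = pK
  present pK pN fwd₁ = pK
  present pK pN wrap₀ = pN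
  present pK pN wrap₁ = pN
  present pK pN origin = true

  presentV : Bool → Bool → Vertex → Bool
  presentV pK pN (old t) = present pK pN t
  presentV pK pN (new x) = true

  -- Where the terminals of the cut after block s + 1 sit, as vertices of the cut after block s.
  newLocation : Terminal → Vertex
  newLocation next = new o₁
  newLocation fwd₀ = new e₀
  newLocation fwd₁ = new e₁
  newLocation wrap₀ = old wrap₀
  newLocation wrap₁ = old wrap₁
  newLocation origin = old origin

  samePath : (Terminal → Terminal) → Terminal → Terminal → Bool
  samePath μ t u = ⌊ t ≟ᵗ u ⌋ ∨ ⌊ μ t ≟ᵗ u ⌋

  -- The step graph of the cut after block s: vertices are the old terminals and the new corners,
  -- edges are the moves of the block table and the pairing of the old terminals.
  module StepGraph (pK pN : Bool) (μ : Terminal → Terminal) (table : Vertex → Dir → Target) where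

    move-edge : Vertex → Vertex → Bool
    move-edge u w = presentV pK pN u ∧ (isTo w (table u viaArc) ∨ isTo w (table u viaSide))

    pair-edge : Vertex → Vertex → Bool
    pair-edge (old t) (old t′) = present pK pN t ∧ ⌊ μ t ≟ᵗ t′ ⌋
    pair-edge _ _ = false

    edge : Vertex → Vertex → Bool
    edge u w = move-edge u w ∨ move-edge w u ∨ pair-edge u w

    reachIn : ℕ → Vertex → Vertex → Bool
    reachIn zero v w = ⌊ v ≟ᵛ w ⌋
    reachIn (suc k) v w = reachIn k v w ∨ anyB (λ u → edge u w ∧ reachIn k v u) vertices

    -- Matching on the source keeps reach v w stuck for a variable v, so that types mentioning it
    -- are not normalised into the (exponentially large) unfolding of reachIn.
    reach : Vertex → Vertex → Bool
    reach (old t) w = reachIn 9 (old t) w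
    reach (new x) w = reachIn 9 (new x) w

  module StepChecks (pK pN q : Bool) (μ μ′ : Terminal → Terminal) (table : Vertex → Dir → Target)
                    (ρ : Terminal → Terminal) (cb : NewCorner → Terminal) where
    open StepGraph pK pN μ table public

    colourOf : Vertex → Terminal
    colourOf (old t) = ρ t
    colourOf (new x) = cb x

    involutive-at new-coloured-at pairs-reached-at : Terminal → Bool
    involutive-at t = present q pN t ⇒ᵇ (present q pN (μ′ t) ∧ ⌊ μ′ (μ′ t) ≟ᵗ t ⌋)
    new-coloured-at t = present q pN t ⇒ᵇ samePath μ′ (colourOf (newLocation t)) t
    pairs-reached-at t = present q pN t ⇒ᵇ reach (newLocation t) (newLocation (μ′ t))

    ρ-respects-at : Terminal → Terminal → Bool
    ρ-respects-at t u = (present pK pN t ∧ present pK pN u ∧ samePath μ t u) ⇒ᵇ samePath μ′ (ρ t) (ρ u)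

    moves-respected-at : Vertex → Dir → Vertex → Bool
    moves-respected-at v d w = (presentV pK pN v ∧ isTo w (table v d)) ⇒ᵇ (presentV pK pN w ∧ samePath μ′ (colourOf v) (colourOf w))

    colour-present-at colour-reached-at : Vertex → Bool
    colour-present-at v = presentV pK pN v ⇒ᵇ present q pN (colourOf v)
    colour-reached-at v = presentV pK pN v ⇒ᵇ reach v (newLocation (colourOf v))

    certified : Bool
    certified = ∀ᵗ involutive-at ∧ ∀ᵗ (λ t → ∀ᵗ (ρ-respects-at t)) ∧ ∀ᵛ (λ v → ∀ᵈ λ d → ∀ᵛ (moves-respected-at v d)) ∧
                ∀ᵗ new-coloured-at ∧ ∀ᵛ colour-present-at ∧ ∀ᵛ colour-reached-at ∧ ∀ᵗ pairs-reached-at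

    record Facts : Set where
      field
        μ′-involutive : ∀ t → T (present q pN t) → μ′ (μ′ t) ≡ t × T (present q pN (μ′ t))
        ρ-respects : ∀ t u → T (present pK pN t) → T (present pK pN u) → T (samePath μ t u) → T (samePath μ′ (ρ t) (ρ u))
        moves-respected : ∀ v d w → T (presentV pK pN v) → table v d ≡ to w →
                          T (presentV pK pN w) × T (samePath μ′ (colourOf v) (colourOf w))
        new-coloured : ∀ t → T (present q pN t) → T (samePath μ′ (colourOf (newLocation t)) t)
        colour-present : ∀ v → T (presentV pK pN v) → T (present q pN (colourOf v))
        colour-reached : ∀ v → T (presentV pK pN v) → T (reach v (newLocation (colourOf v)))
        pairs-reached : ∀ t → T (present q pN t) → T (reach (newLocation t) (newLocation (μ′ t)))

    facts : T certified → Facts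
    facts c = record
      { μ′-involutive = λ t p → let h = modus-ponens (∀ᵗ-elim involutive-at (T-∧ˡ {a} c) t) p in
                                  toWitness (T-∧ʳ {present q pN (μ′ t)} h) , T-∧ˡ h
      ; ρ-respects = λ t u pt pu st → modus-ponens (∀ᵗ-elim (ρ-respects-at t) (∀ᵗ-elim (λ t → ∀ᵗ (ρ-respects-at t)) (T-∧ˡ {b} c₁) t) u)
                                        (Equivalence.from T-∧ (pt , Equivalence.from T-∧ (pu , st)))
      ; moves-respected = λ v d w pv e → let h = modus-ponens (∀ᵛ-elim (moves-respected-at v d)
                                                    (∀ᵈ-elim (λ d → ∀ᵛ (moves-respected-at v d)) (∀ᵛ-elim (λ v → ∀ᵈ λ d → ∀ᵛ (moves-respected-at v d)) (T-∧ˡ {m} c₂) v) d) w)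
                                                    (Equivalence.from T-∧ (pv , subst (λ o → T (isTo w o)) (sym e) (fromWitness refl))) in
                                           T-∧ˡ h , T-∧ʳ {presentV pK pN w} h
      ; new-coloured = λ t → modus-ponens (∀ᵗ-elim new-coloured-at (T-∧ˡ {nw} c₃) t)
      ; colour-present = λ v → modus-ponens (∀ᵛ-elim colour-present-at (T-∧ˡ {pr} c₄) v)
      ; colour-reached = λ v → modus-ponens (∀ᵛ-elim colour-reached-at (T-∧ˡ {rc} c₅) v)
      ; pairs-reached = λ t → modus-ponens (∀ᵗ-elim pairs-reached-at (T-∧ʳ {rc} c₅) t) }
      where
        a = ∀ᵗ involutive-at
        b = ∀ᵗ (λ t → ∀ᵗ (ρ-respects-at t))
        m = ∀ᵛ (λ v → ∀ᵈ λ d → ∀ᵛ (moves-respected-at v d))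
        nw = ∀ᵗ new-coloured-at
        pr = ∀ᵛ colour-present-at
        rc = ∀ᵛ colour-reached-at
        pa = ∀ᵗ pairs-reached-at
        c₁ = T-∧ʳ {a} {b ∧ m ∧ nw ∧ pr ∧ rc ∧ pa} c
        c₂ = T-∧ʳ {b} {m ∧ nw ∧ pr ∧ rc ∧ pa} c₁
        c₃ = T-∧ʳ {m} {nw ∧ pr ∧ rc ∧ pa} c₂
        c₄ = T-∧ʳ {nw} {pr ∧ rc ∧ pa} c₃
        c₅ = T-∧ʳ {pr} {rc ∧ pa} c₄

  module SeparationChecks (pK pN : Bool) (μ : Terminal → Terminal) (table : Vertex → Dir → Target)
                          (kept : Vertex → Bool) (B : Vertex → Bool) (v₀ : Vertex) where

    B-paths-at : Terminal → Terminal → Bool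
    B-paths-at t u = (present pK pN t ∧ present pK pN u ∧ samePath μ t u) ⇒ᵇ ⌊ B (old t) Bool.≟ B (old u) ⌋

    B-moves-at : Vertex → Dir → Vertex → Bool
    B-moves-at v d w = (presentV pK pN v ∧ isTo w (table v d)) ⇒ᵇ (presentV pK pN w ∧ ⌊ B v Bool.≟ B w ⌋)

    B-inside-at : Vertex → Dir → Bool
    B-inside-at v d = (presentV pK pN v ∧ isOutside (table v d)) ⇒ᵇ not (B v)

    certified : Bool
    certified = ∀ᵗ (λ t → ∀ᵗ (B-paths-at t)) ∧ ∀ᵛ (λ v → ∀ᵈ λ d → ∀ᵛ (B-moves-at v d)) ∧ ∀ᵛ (λ v → ∀ᵈ (B-inside-at v)) ∧
                not (B (old origin)) ∧ B v₀ ∧ presentV pK pN v₀ ∧ kept v₀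

    record Facts : Set where
      field
        B-paths : ∀ t u → T (present pK pN t) → T (present pK pN u) → T (samePath μ t u) → B (old t) ≡ B (old u)
        B-moves : ∀ v d w → T (presentV pK pN v) → table v d ≡ to w → T (presentV pK pN w) × B v ≡ B w
        B-inside : ∀ v d → T (presentV pK pN v) → table v d ≡ outside → T (not (B v))
        origin-unmarked : T (not (B (old origin)))
        witness-marked : T (B v₀)
        witness-present : T (presentV pK pN v₀)
        witness-kept : T (kept v₀)

    facts : T certified → Facts
    facts c = record
      { B-paths = λ t u pt pu st → toWitness (modus-ponens (∀ᵗ-elim (B-paths-at t) (∀ᵗ-elim (λ t → ∀ᵗ (B-paths-at t)) (T-∧ˡ {bp} c) t) u)
                                      (Equivalence.from T-∧ (pt , Equivalence.from T-∧ (pu , st))))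
      ; B-moves = λ v d w pv e → let h = modus-ponens (∀ᵛ-elim (B-moves-at v d)
                                            (∀ᵈ-elim (λ d → ∀ᵛ (B-moves-at v d)) (∀ᵛ-elim (λ v → ∀ᵈ λ d → ∀ᵛ (B-moves-at v d)) (T-∧ˡ {bm} c₁) v) d) w)
                                            (Equivalence.from T-∧ (pv , subst (λ o → T (isTo w o)) (sym e) (fromWitness refl))) in
                                   T-∧ˡ h , toWitness (T-∧ʳ {presentV pK pN w} h)
      ; B-inside = λ v d pv e → modus-ponens (∀ᵈ-elim (B-inside-at v) (∀ᵛ-elim (λ v → ∀ᵈ (B-inside-at v)) (T-∧ˡ {bi} c₂) v) d)
                                   (Equivalence.from T-∧ (pv , subst (λ o → T (isOutside o)) (sym e) tt))
      ; origin-unmarked = T-∧ˡ {not (B (old origin))} c₃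
      ; witness-marked = T-∧ˡ {B v₀} c₄
      ; witness-present = T-∧ˡ {presentV pK pN v₀} c₅
      ; witness-kept = T-∧ʳ {presentV pK pN v₀} c₅ }
      where
        bp = ∀ᵗ (λ t → ∀ᵗ (B-paths-at t))
        bm = ∀ᵛ (λ v → ∀ᵈ λ d → ∀ᵛ (B-moves-at v d))
        bi = ∀ᵛ (λ v → ∀ᵈ (B-inside-at v))
        c₁ = T-∧ʳ {bp} {bm ∧ bi ∧ not (B (old origin)) ∧ B v₀ ∧ presentV pK pN v₀ ∧ kept v₀} c
        c₂ = T-∧ʳ {bm} {bi ∧ not (B (old origin)) ∧ B v₀ ∧ presentV pK pN v₀ ∧ kept v₀} c₁
        c₃ = T-∧ʳ {bi} {not (B (old origin)) ∧ B v₀ ∧ presentV pK pN v₀ ∧ kept v₀} c₂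
        c₄ = T-∧ʳ {not (B (old origin))} {B v₀ ∧ presentV pK pN v₀ ∧ kept v₀} c₃
        c₅ = T-∧ʳ {B v₀} {presentV pK pN v₀ ∧ kept v₀} c₄

  module ConnectionChecks (pK pN : Bool) (μ : Terminal → Terminal) (table : Vertex → Dir → Target) where
    open StepGraph pK pN μ table public

    reaches-origin-at : Vertex → Bool
    reaches-origin-at v = presentV pK pN v ⇒ᵇ reach v (old origin)

    certified : Bool
    certified = ∀ᵛ reaches-origin-at

    reaches-origin : T certified → ∀ v → T (presentV pK pN v) → T (reach v (old origin))
    reaches-origin c v = modus-ponens (∀ᵛ-elim reaches-origin-at c v)

  -- Transfer matrix: soundness on the corner graph

  SamePath : (Terminal → Terminal) → Terminal → Terminal → Set
  SamePath μ t u = t ≡ u ⊎ μ t ≡ u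

  samePath-sound : ∀ μ t u → T (samePath μ t u) → SamePath μ t u
  samePath-sound μ t u h with T-∨⁻ {⌊ t ≟ᵗ u ⌋} h
  ... | inj₁ e = inj₁ (toWitness e)
  ... | inj₂ e = inj₂ (toWitness e)

  samePath-complete : ∀ μ t u → SamePath μ t u → T (samePath μ t u)
  samePath-complete μ t u (inj₁ e) = Equivalence.from (T-∨ {⌊ t ≟ᵗ u ⌋} {⌊ μ t ≟ᵗ u ⌋}) (inj₁ (fromWitness e))
  samePath-complete μ t u (inj₂ e) = Equivalence.from (T-∨ {⌊ t ≟ᵗ u ⌋} {⌊ μ t ≟ᵗ u ⌋}) (inj₂ (fromWitness e))

  module SamePathReasoning (μ : Terminal → Terminal) (pr : Terminal → Bool)
                           (involutive : ∀ t → T (pr t) → μ (μ t) ≡ t × T (pr (μ t))) where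

    SamePath-sym : ∀ t u → T (pr t) → SamePath μ t u → SamePath μ u t
    SamePath-sym t .t p (inj₁ refl) = inj₁ refl
    SamePath-sym t .(μ t) p (inj₂ refl) = inj₂ (proj₁ (involutive t p))

    SamePath-trans : ∀ t u v → T (pr t) → SamePath μ t u → SamePath μ u v → SamePath μ t v
    SamePath-trans t .t v p (inj₁ refl) s = s
    SamePath-trans t .(μ t) .(μ t) p (inj₂ refl) (inj₁ refl) = inj₂ refl
    SamePath-trans t .(μ t) .(μ (μ t)) p (inj₂ refl) (inj₂ refl) = inj₁ (sym (proj₁ (involutive t p)))

  T-not-T : ∀ {b} → T (not b) → T b → ⊥
  T-not-T {true} () _

  <ᵇ-false : ∀ {m n} → ¬ m < n → (m <ᵇ n) ≡ false
  <ᵇ-false {m} {n} m≮n with m <ᵇ n in e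
  ... | true = ⊥-elim (m≮n (<ᵇ⇒< m n (subst T (sym e) tt)))
  ... | false = refl

  module TransferMatrix (k : ℕ) (F : List Bool) where
    open W¹Spanning k F public

    move : Dir → Corner → Corner
    move viaArc = U.arc
    move viaSide = sideF

    Conn-move : ∀ c d → U.valid c → G.Conn c (move d c)
    Conn-move c viaArc v = G.f-step v G.done
    Conn-move c viaSide v = G.g-step v G.done

    InBlocks : ℕ → Corner → Set
    InBlocks s c = proj₁ c < double (suc s)

    loc : ℕ → Terminal → Corner
    loc s next = corner s true true
    loc s fwd₀ = corner s false false
    loc s fwd₁ = corner s false true
    loc s wrap₀ = corner 0 true false
    loc s wrap₁ = corner 0 true true
    loc s origin = corner 0 false false

    newCorner : ℕ → NewCorner → Corner
    newCorner j e₀ = corner j false false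
    newCorner j e₁ = corner j false true
    newCorner j o₀ = corner j true false
    newCorner j o₁ = corner j true true

    emb : ℕ → Vertex → Corner
    emb s (old t) = loc s t
    emb s (new x) = newCorner (suc s) x

    emb-newLocation : ∀ s t → emb s (newLocation t) ≡ loc (suc s) t
    emb-newLocation s next = refl
    emb-newLocation s fwd₀ = refl
    emb-newLocation s fwd₁ = refl
    emb-newLocation s wrap₀ = refl
    emb-newLocation s wrap₁ = refl
    emb-newLocation s origin = refl

    InBlocks-suc : ∀ s c → InBlocks s c → InBlocks (suc s) c
    InBlocks-suc s c lt = <-trans lt (double-mono-< (suc s) (suc (suc s)) (n<1+n _))

    InBlocks-split : ∀ s c → InBlocks (suc s) c → InBlocks s c ⊎ Σ NewCorner λ x → c ≡ newCorner (suc s) x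
    InBlocks-split s (P , b) lt with m≤n⇒m<n∨m≡n (≤-pred lt)
    ... | inj₂ refl = inj₂ (odd-corner b)
      where
        odd-corner : ∀ b → Σ NewCorner λ x → (suc (double (suc s)) , b) ≡ newCorner (suc s) x
        odd-corner false = o₀ , refl
        odd-corner true = o₁ , refl
    ... | inj₁ lt′ with m≤n⇒m<n∨m≡n (≤-pred lt′)
    ...   | inj₁ lt″ = inj₁ lt″
    ...   | inj₂ refl = inj₂ (even-corner b)
      where
        even-corner : ∀ b → Σ NewCorner λ x → (double (suc s) , b) ≡ newCorner (suc s) x
        even-corner false = e₀ , refl
        even-corner true = e₁ , refl

    newCorner-beyond : ∀ s x → ¬ InBlocks s (newCorner (suc s) x)
    newCorner-beyond s e₀ lt = <-irrefl refl lt
    newCorner-beyond s e₁ lt = <-irrefl refl lt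
    newCorner-beyond s o₀ lt = <-irrefl refl (<-trans (n<1+n _) lt)
    newCorner-beyond s o₁ lt = <-irrefl refl (<-trans (n<1+n _) lt)

    newCorner-inside : ∀ s x → InBlocks (suc s) (newCorner (suc s) x)
    newCorner-inside s e₀ = s≤s (s≤s (s≤s (n≤1+n _)))
    newCorner-inside s e₁ = s≤s (s≤s (s≤s (n≤1+n _)))
    newCorner-inside s o₀ = s≤s (s≤s (s≤s ≤-refl))
    newCorner-inside s o₁ = s≤s (s≤s (s≤s ≤-refl))

    loc-inside : ∀ s t → InBlocks s (loc s t)
    loc-inside s next = ≤-refl
    loc-inside s fwd₀ = <-trans (n<1+n _) (n<1+n _)
    loc-inside s fwd₁ = <-trans (n<1+n _) (n<1+n _)
    loc-inside s wrap₀ = s≤s (s≤s z≤n)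
    loc-inside s wrap₁ = s≤s (s≤s z≤n)
    loc-inside s origin = s≤s z≤n

    InBlocks-valid : ∀ s → suc s ≤ n → ∀ c → InBlocks s c → U.valid c
    InBlocks-valid s le c c< = <-≤-trans c< (subst (double (suc s) ≤_) (sym length-W¹) (double-mono-≤ _ _ le))

    -- colour c names an end of the path through c within blocks 0 … s, and μ pairs the two ends of
    -- each such path; so no boundary component closes up inside these blocks.
    record Invariant (s : ℕ) (μ : Terminal → Terminal) (pK pN : Bool) : Set where
      field
        colour : Corner → Terminal
        μ-involutive : ∀ t → T (present pK pN t) → μ (μ t) ≡ t × T (present pK pN (μ t))
        colour-moves : ∀ c d → InBlocks s c → InBlocks s (move d c) → SamePath μ (colour c) (colour (move d c))
        colour-loc : ∀ t → T (present pK pN t) → SamePath μ (colour (loc s t)) t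
        reaches-loc : ∀ c → InBlocks s c → G.Conn c (loc s (colour c))
        colour-present : ∀ c → InBlocks s c → T (present pK pN (colour c))
        μ-connected : ∀ t → T (present pK pN t) → G.Conn (loc s t) (loc s (μ t))

    Separated : Set₁
    Separated = Σ (Corner → Set) λ S → G.Closed S × (∃ λ P → ∃ λ b → P < N × keptAt L P ≡ true × S (P , b)) × ¬ S (0 , false)

    Lands : ℕ → Corner → Target → Set
    Lands s y inside = ⊥
    Lands s y outside = ¬ InBlocks (suc s) y
    Lands s y (to w) = y ≡ emb s w

    LeavesBy : ℕ → Bool → Bool → (Vertex → Dir → Target) → Corner → Dir → Set
    LeavesBy s pK pN table c d = Σ Terminal λ t → T (present pK pN t) × c ≡ loc s t × T (not (isInside (table (old t) d)))

    record BlockGeometry (s : ℕ) (pK pN : Bool) (table : Vertex → Dir → Target) (kept : Vertex → Bool) : Set where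
      field
        bound : suc (suc s) ≤ n
        new-moves : ∀ x d → Lands s (move d (newCorner (suc s) x)) (table (new x) d)
        old-moves : ∀ c → InBlocks s c → ∀ d → InBlocks s (move d c) ⊎ LeavesBy s pK pN table c d
        terminal-moves : ∀ t d → T (present pK pN t) → T (not (isInside (table (old t) d))) → Lands s (move d (loc s t)) (table (old t) d)
        kept-sound : ∀ v → T (kept v) → keptAt L (proj₁ (emb s v)) ≡ true

      InBlocks⁺-valid : ∀ c → InBlocks (suc s) c → U.valid c
      InBlocks⁺-valid = InBlocks-valid (suc s) bound

      emb-valid : ∀ v → U.valid (emb s v)
      emb-valid (old t) = InBlocks⁺-valid (loc s t) (InBlocks-suc s (loc s t) (loc-inside s t))
      emb-valid (new x) = InBlocks⁺-valid (newCorner (suc s) x) (newCorner-inside s x)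

    module StepGraphSound {s : ℕ} {pK pN : Bool} {μ : Terminal → Terminal} {table : Vertex → Dir → Target} {kept : Vertex → Bool}
                          (geo : BlockGeometry s pK pN table kept)
                          (μ-connected : ∀ t → T (present pK pN t) → G.Conn (loc s t) (loc s (μ t))) where
      open BlockGeometry geo
      open StepGraph pK pN μ table

      lands-to : ∀ v d w → T (presentV pK pN v) → table v d ≡ to w → move d (emb s v) ≡ emb s w
      lands-to (new x) d w _ e = subst (Lands s (move d (newCorner (suc s) x))) e (new-moves x d)
      lands-to (old t) d w p e =
        subst (Lands s (move d (loc s t))) e (terminal-moves t d p (subst (λ o → T (not (isInside o))) (sym e) tt))

      move-edge-sound : ∀ u w → T (move-edge u w) → G.Conn (emb s u) (emb s w)
      move-edge-sound u w h with T-∨⁻ {isTo w (table u viaArc)} (T-∧ʳ {presentV pK pN u} h)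
      ... | inj₁ a = subst (G.Conn (emb s u)) (lands-to u viaArc w (T-∧ˡ h) (isTo-sound w _ a)) (Conn-move (emb s u) viaArc (emb-valid u))
      ... | inj₂ a = subst (G.Conn (emb s u)) (lands-to u viaSide w (T-∧ˡ h) (isTo-sound w _ a)) (Conn-move (emb s u) viaSide (emb-valid u))

      pair-edge-sound : ∀ u w → T (pair-edge u w) → G.Conn (emb s u) (emb s w)
      pair-edge-sound (old t) (old t′) h =
        subst (λ z → G.Conn (loc s t) (loc s z)) (toWitness (T-∧ʳ {present pK pN t} h)) (μ-connected t (T-∧ˡ h))

      edge-sound : ∀ u w → T (edge u w) → G.Conn (emb s u) (emb s w)
      edge-sound u w h with T-∨⁻ {move-edge u w} h
      ... | inj₁ e = move-edge-sound u w e
      ... | inj₂ h′ with T-∨⁻ {move-edge w u} h′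
      ...   | inj₁ e = GI.Conn-sym (emb-valid w) (move-edge-sound w u e)
      ...   | inj₂ e = pair-edge-sound u w e

      reachIn-sound : ∀ i v w → T (reachIn i v w) → G.Conn (emb s v) (emb s w)
      reachIn-sound zero v w h rewrite toWitness h = G.done
      reachIn-sound (suc i) v w h with T-∨⁻ {reachIn i v w} h
      ... | inj₁ h′ = reachIn-sound i v w h′
      ... | inj₂ h′ with anyB-witness (λ u → edge u w ∧ reachIn i v u) vertices h′
      ...   | u , hu = G.Conn-trans (reachIn-sound i v u (T-∧ʳ {edge u w} hu)) (edge-sound u w (T-∧ˡ hu))

      reach-sound : ∀ v w → T (reach v w) → G.Conn (emb s v) (emb s w)
      reach-sound (old t) = reachIn-sound 9 (old t)
      reach-sound (new x) = reachIn-sound 9 (new x)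

    module Step {s : ℕ} {pK pN q : Bool} {μ μ′ : Terminal → Terminal} {table : Vertex → Dir → Target} {ρ : Terminal → Terminal}
                {cb : NewCorner → Terminal} {kept : Vertex → Bool} (geo : BlockGeometry s pK pN table kept) (I : Invariant s μ pK pN)
                (facts : StepChecks.Facts pK pN q μ μ′ table ρ cb) where
      open BlockGeometry geo
      open Invariant I
      open StepChecks pK pN q μ μ′ table ρ cb using (colourOf; reach)
      open StepChecks.Facts facts renaming (colour-present to present-sound)
      open StepGraphSound {μ = μ} geo μ-connected

      open SamePathReasoning μ′ (present q pN) μ′-involutive

      ρ-sound : ∀ t u → T (present pK pN t) → T (present pK pN u) → SamePath μ t u → SamePath μ′ (ρ t) (ρ u)
      ρ-sound t u pt pu st = samePath-sound μ′ (ρ t) (ρ u) (ρ-respects t u pt pu (samePath-complete μ t u st))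

      moves-sound : ∀ v d w → T (presentV pK pN v) → table v d ≡ to w → T (presentV pK pN w) × SamePath μ′ (colourOf v) (colourOf w)
      moves-sound v d w pv e = proj₁ (moves-respected v d w pv e) , samePath-sound μ′ _ _ (proj₂ (moves-respected v d w pv e))

      colour′ : Corner → Terminal
      colour′ (P , b) = if P <ᵇ double (suc s) then ρ (colour (P , b)) else
                        (if P == double (suc s) then cb (if b then e₁ else e₀) else cb (if b then o₁ else o₀))

      colour′-old : ∀ c → InBlocks s c → colour′ c ≡ ρ (colour c)
      colour′-old (P , b) lt rewrite Equivalence.to T-≡ (<⇒<ᵇ lt) = refl

      colour′-new : ∀ x → colour′ (newCorner (suc s) x) ≡ cb x
      colour′-new e₀ rewrite <ᵇ-false (newCorner-beyond s e₀) | ≡⇒== (double (suc s)) _ refl = refl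
      colour′-new e₁ rewrite <ᵇ-false (newCorner-beyond s e₁) | ≡⇒== (double (suc s)) _ refl = refl
      colour′-new o₀ rewrite <ᵇ-false (newCorner-beyond s o₀) | ≢⇒== (suc (double (suc s))) _ (λ e → <⇒≢ (n<1+n _) (sym e)) = refl
      colour′-new o₁ rewrite <ᵇ-false (newCorner-beyond s o₁) | ≢⇒== (suc (double (suc s))) _ (λ e → <⇒≢ (n<1+n _) (sym e)) = refl

      colour′-emb : ∀ v → T (presentV pK pN v) → SamePath μ′ (colour′ (emb s v)) (colourOf v)
      colour′-emb (old t) pv = subst (λ z → SamePath μ′ z (ρ t)) (sym (colour′-old (loc s t) (loc-inside s t)))
        (ρ-sound (colour (loc s t)) t (colour-present (loc s t) (loc-inside s t)) pv (colour-loc t pv))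
      colour′-emb (new x) pv = inj₁ (colour′-new x)

      colour′-emb-present : ∀ v → T (presentV pK pN v) → T (present q pN (colour′ (emb s v)))
      colour′-emb-present (old t) pv = subst (λ z → T (present q pN z)) (sym (colour′-old (loc s t) (loc-inside s t)))
        (present-sound (old (colour (loc s t))) (colour-present (loc s t) (loc-inside s t)))
      colour′-emb-present (new x) pv = subst (λ z → T (present q pN z)) (sym (colour′-new x)) (present-sound (new x) pv)

      colour′-move : ∀ v d w → T (presentV pK pN v) → table v d ≡ to w → SamePath μ′ (colour′ (emb s v)) (colour′ (emb s w))
      colour′-move v d w pv e =
        SamePath-trans _ _ _ (colour′-emb-present v pv) (colour′-emb v pv)
          (SamePath-trans _ _ _ (present-sound v pv) (proj₂ (moves-sound v d w pv e))
            (SamePath-sym _ _ (colour′-emb-present w pw) (colour′-emb w pw)))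
        where pw = proj₁ (moves-sound v d w pv e)

      lands-inside : ∀ v d y → T (presentV pK pN v) → Lands s y (table v d) → InBlocks (suc s) y → Σ Vertex λ w → table v d ≡ to w × y ≡ emb s w
      lands-inside v d y pv l y∈ with table v d
      ... | outside = ⊥-elim (l y∈)
      ... | to w = w , refl , l

      colour′-moves : ∀ c d → InBlocks (suc s) c → InBlocks (suc s) (move d c) → SamePath μ′ (colour′ c) (colour′ (move d c))
      colour′-moves c d c∈ m∈ with InBlocks-split s c c∈
      ... | inj₂ (x , refl) with lands-inside (new x) d _ tt (new-moves x d) m∈
      ...   | w , e , m≡ = subst (λ z → SamePath μ′ (colour′ (newCorner (suc s) x)) (colour′ z)) (sym m≡) (colour′-move (new x) d w tt e)
      colour′-moves c d c∈ m∈ | inj₁ c∈₀ with old-moves c c∈₀ d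
      ... | inj₁ m∈₀ = subst₂ (SamePath μ′) (sym (colour′-old c c∈₀)) (sym (colour′-old (move d c) m∈₀))
                         (ρ-sound _ _ (colour-present c c∈₀) (colour-present (move d c) m∈₀) (colour-moves c d c∈₀ m∈₀))
      ... | inj₂ (t , pt , refl , leaves) with lands-inside (old t) d _ pt (terminal-moves t d pt leaves) m∈
      ...   | w , e , m≡ = subst (λ z → SamePath μ′ (colour′ (loc s t)) (colour′ z)) (sym m≡) (colour′-move (old t) d w pt e)

      newLocation-present : ∀ t → T (present q pN t) → T (presentV pK pN (newLocation t))
      newLocation-present next p = tt
      newLocation-present fwd₀ p = tt
      newLocation-present fwd₁ p = tt
      newLocation-present wrap₀ p = p
      newLocation-present wrap₁ p = p
      newLocation-present origin p = tt

      colour′-loc : ∀ t → T (present q pN t) → SamePath μ′ (colour′ (loc (suc s) t)) t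
      colour′-loc t p = subst (λ z → SamePath μ′ (colour′ z) t) (emb-newLocation s t)
        (SamePath-trans _ _ _ (colour′-emb-present v pv) (colour′-emb v pv)
          (samePath-sound μ′ _ _ (new-coloured t p)))
        where
          v = newLocation t
          pv = newLocation-present t p

      reaches-colour : ∀ v → T (presentV pK pN v) → G.Conn (emb s v) (loc (suc s) (colourOf v))
      reaches-colour v pv = subst (G.Conn (emb s v)) (emb-newLocation s (colourOf v)) (reach-sound v _ (colour-reached v pv))

      reaches-loc′ : ∀ c → InBlocks (suc s) c → G.Conn c (loc (suc s) (colour′ c))
      reaches-loc′ c c∈ with InBlocks-split s c c∈
      ... | inj₁ c∈₀ = subst (λ z → G.Conn c (loc (suc s) z)) (sym (colour′-old c c∈₀))
                         (G.Conn-trans (reaches-loc c c∈₀) (reaches-colour (old (colour c)) (colour-present c c∈₀)))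
      ... | inj₂ (x , refl) = subst (λ z → G.Conn (newCorner (suc s) x) (loc (suc s) z)) (sym (colour′-new x)) (reaches-colour (new x) tt)

      colour′-present : ∀ c → InBlocks (suc s) c → T (present q pN (colour′ c))
      colour′-present c c∈ with InBlocks-split s c c∈
      ... | inj₁ c∈₀ = subst (λ z → T (present q pN z)) (sym (colour′-old c c∈₀)) (present-sound (old (colour c)) (colour-present c c∈₀))
      ... | inj₂ (x , refl) = subst (λ z → T (present q pN z)) (sym (colour′-new x)) (present-sound (new x) tt)

      μ′-connected : ∀ t → T (present q pN t) → G.Conn (loc (suc s) t) (loc (suc s) (μ′ t))
      μ′-connected t p = subst₂ G.Conn (emb-newLocation s t) (emb-newLocation s (μ′ t))
        (reach-sound (newLocation t) (newLocation (μ′ t)) (pairs-reached t p))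

      invariant : Invariant (suc s) μ′ q pN
      invariant = record
        { colour = colour′ ; μ-involutive = μ′-involutive ; colour-moves = colour′-moves ; colour-loc = colour′-loc
        ; reaches-loc = reaches-loc′ ; colour-present = colour′-present ; μ-connected = μ′-connected }

    module Separation {s : ℕ} {pK pN : Bool} {μ : Terminal → Terminal} {table : Vertex → Dir → Target} {kept B : Vertex → Bool} {v₀ : Vertex}
                      (geo : BlockGeometry s pK pN table kept) (I : Invariant s μ pK pN)
                      (facts : SeparationChecks.Facts pK pN μ table kept B v₀) where
      open BlockGeometry geo
      open Invariant I
      open SeparationChecks.Facts facts

      B-colour : ∀ t → T (present pK pN t) → B (old (colour (loc s t))) ≡ B (old t)
      B-colour t pt = B-paths _ t (colour-present (loc s t) (loc-inside s t)) pt (samePath-complete μ _ t (colour-loc t pt))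

      Marked : Corner → Set
      Marked c = (InBlocks s c × T (B (old (colour c)))) ⊎ Σ NewCorner λ x → c ≡ newCorner (suc s) x × T (B (new x))

      Marked-emb : ∀ w → T (presentV pK pN w) → T (B w) → Marked (emb s w)
      Marked-emb (old t) pw bw = inj₁ (loc-inside s t , subst T (sym (B-colour t pw)) bw)
      Marked-emb (new x) pw bw = inj₂ (x , refl , bw)

      Marked-move : ∀ v d → T (presentV pK pN v) → T (B v) → Lands s (move d (emb s v)) (table v d) → Marked (move d (emb s v))
      Marked-move v d pv bv l with table v d in e
      ... | outside = ⊥-elim (T-not-T (B-inside v d pv e) bv)
      ... | to w = subst Marked (sym l) (Marked-emb w (proj₁ (B-moves v d w pv e)) (subst T (proj₂ (B-moves v d w pv e)) bv))

      Marked-closed : G.Closed Marked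
      Marked-closed c _ m = closed-under viaArc m , closed-under viaSide m
        where
          closed-under : ∀ d → Marked c → Marked (move d c)
          closed-under d (inj₁ (c∈ , bc)) with old-moves c c∈ d
          ... | inj₁ m∈ = inj₁ (m∈ , subst T (B-paths _ _ (colour-present c c∈) (colour-present _ m∈)
                                         (samePath-complete μ _ _ (colour-moves c d c∈ m∈))) bc)
          ... | inj₂ (t , pt , refl , leaves) = Marked-move (old t) d pt (subst T (B-colour t pt) bc) (terminal-moves t d pt leaves)
          closed-under d (inj₂ (x , refl , bx)) = Marked-move (new x) d tt bx (new-moves x d)

      origin-not-Marked : ¬ Marked (0 , false)
      origin-not-Marked (inj₁ (_ , b)) = T-not-T origin-unmarked (subst T (B-colour origin tt) b)
      origin-not-Marked (inj₂ (e₀ , () , _))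
      origin-not-Marked (inj₂ (e₁ , () , _))
      origin-not-Marked (inj₂ (o₀ , () , _))
      origin-not-Marked (inj₂ (o₁ , () , _))

      separated : Separated
      separated = Marked , Marked-closed ,
        (proj₁ (emb s v₀) , proj₂ (emb s v₀) , emb-valid v₀ , kept-sound v₀ witness-kept , Marked-emb v₀ witness-present witness-marked) ,
        origin-not-Marked

    module Connection {s : ℕ} {pK pN : Bool} {μ : Terminal → Terminal} {table : Vertex → Dir → Target} {kept : Vertex → Bool}
                      (geo : BlockGeometry s pK pN table kept) (I : Invariant s μ pK pN)
                      (last-block : suc (suc s) ≡ n)
                      (reaches-origin : ∀ v → T (presentV pK pN v) → T (StepGraph.reach pK pN μ table v (old origin))) where
      open BlockGeometry geo
      open Invariant I
      open StepGraphSound {μ = μ} geo μ-connected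

      all-connected : ∀ c → U.valid c → G.Conn c (0 , false)
      all-connected c v with InBlocks-split s c (subst (proj₁ c <_) (trans length-W¹ (cong double (sym last-block))) v)
      ... | inj₁ c∈ = G.Conn-trans (reaches-loc c c∈) (reach-sound (old (colour c)) (old origin) (reaches-origin _ (colour-present c c∈)))
      ... | inj₂ (x , refl) = reach-sound (new x) (old origin) (reaches-origin (new x) tt)

  -- The blocks of W¹ₙ

  -- first = true for block s = 0, whose forward edge is the twisted edge 1
  middleTable : Bool → Bool → Bool → Bool → Vertex → Dir → Target
  middleTable first pK q pN (old next) viaArc = to (new e₀)
  middleTable first pK q pN (old next) viaSide = inside
  middleTable first pK q pN (old fwd₀) viaArc = inside
  middleTable first pK q pN (old fwd₀) viaSide = if pK then to (new (if first then o₀ else o₁)) else inside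
  middleTable first pK q pN (old fwd₁) viaArc = inside
  middleTable first pK q pN (old fwd₁) viaSide = if pK then to (new (if first then o₁ else o₀)) else inside
  middleTable first pK q pN (old wrap₀) viaArc = inside
  middleTable first pK q pN (old wrap₀) viaSide = if pN then outside else inside
  middleTable first pK q pN (old wrap₁) viaArc = inside
  middleTable first pK q pN (old wrap₁) viaSide = if pN then outside else inside
  middleTable first pK q pN (old origin) viaArc = outside
  middleTable first pK q pN (old origin) viaSide = inside
  middleTable first pK q pN (new e₀) viaArc = to (old next)
  middleTable first pK q pN (new e₀) viaSide = if q then outside else to (new e₁)
  middleTable first pK q pN (new e₁) viaArc = to (new o₀)
  middleTable first pK q pN (new e₁) viaSide = if q then outside else to (new e₀)
  middleTable first pK q pN (new o₀) viaArc = to (new e₁)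
  middleTable first pK q pN (new o₀) viaSide = if pK then to (old (if first then fwd₀ else fwd₁)) else to (new o₁)
  middleTable first pK q pN (new o₁) viaArc = outside
  middleTable first pK q pN (new o₁) viaSide = if pK then to (old (if first then fwd₁ else fwd₀)) else to (new o₀)

  lastTable : Bool → Bool → Vertex → Dir → Target
  lastTable pK pN (old next) viaArc = to (new e₀)
  lastTable pK pN (old next) viaSide = inside
  lastTable pK pN (old fwd₀) viaArc = inside
  lastTable pK pN (old fwd₀) viaSide = if pK then to (new o₁) else inside
  lastTable pK pN (old fwd₁) viaArc = inside
  lastTable pK pN (old fwd₁) viaSide = if pK then to (new o₀) else inside
  lastTable pK pN (old wrap₀) viaArc = inside
  lastTable pK pN (old wrap₀) viaSide = if pN then to (new e₁) else inside
  lastTable pK pN (old wrap₁) viaArc = inside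
  lastTable pK pN (old wrap₁) viaSide = if pN then to (new e₀) else inside
  lastTable pK pN (old origin) viaArc = to (new o₁)
  lastTable pK pN (old origin) viaSide = inside
  lastTable pK pN (new e₀) viaArc = to (old next)
  lastTable pK pN (new e₀) viaSide = if pN then to (old wrap₁) else to (new e₁)
  lastTable pK pN (new e₁) viaArc = to (new o₀)
  lastTable pK pN (new e₁) viaSide = if pN then to (old wrap₀) else to (new e₀)
  lastTable pK pN (new o₀) viaArc = to (new e₁)
  lastTable pK pN (new o₀) viaSide = if pK then to (old fwd₁) else to (new o₁)
  lastTable pK pN (new o₁) viaArc = to (old origin)
  lastTable pK pN (new o₁) viaSide = if pK then to (old fwd₀) else to (new o₀)

  keptVertex : Bool → Bool → Bool → Vertex → Bool
  keptVertex pK pN q (old next) = false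
  keptVertex pK pN q (old fwd₀) = pK
  keptVertex pK pN q (old fwd₁) = pK
  keptVertex pK pN q (old wrap₀) = pN
  keptVertex pK pN q (old wrap₁) = pN
  keptVertex pK pN q (old origin) = false
  keptVertex pK pN q (new e₀) = q
  keptVertex pK pN q (new e₁) = q
  keptVertex pK pN q (new o₀) = pK
  keptVertex pK pN q (new o₁) = pK

  matching : List (Terminal × Terminal) → Terminal → Terminal
  matching [] t = t
  matching ((a , b) ∷ ps) t with ⌊ t ≟ᵗ a ⌋ | ⌊ t ≟ᵗ b ⌋
  ... | true | _ = b
  ... | false | true = a
  ... | false | false = matching ps t

  initialPairing : Bool → Bool → Terminal → Terminal
  initialPairing false false = matching ((next , origin) ∷ [])
  initialPairing true false = matching ((next , fwd₁) ∷ (fwd₀ , origin) ∷ [])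
  initialPairing false true = matching ((next , wrap₁) ∷ (wrap₀ , origin) ∷ [])
  initialPairing true true = matching ((next , wrap₁) ∷ (fwd₀ , origin) ∷ (fwd₁ , wrap₀) ∷ [])

  module W¹Blocks (k : ℕ) (F : List Bool) where
    open TransferMatrix k F public

    side-position : ∀ P b → proj₁ (sideF (P , b)) ≡ P ⊎ (keptAt L P ≡ true × proj₁ (sideF (P , b)) ≡ mate P)
    side-position P b with keptAt L P in kept
    ... | true = inj₂ (refl , refl)
    ... | false = inj₁ refl

    even-≤ : ∀ j s → double j < double (suc s) → j ≤ s
    even-≤ j s lt = ≤-pred (double-<-reflect j (suc s) lt)

    odd-≤ : ∀ j s → suc (double j) < double (suc s) → j ≤ s
    odd-≤ j s lt = ≤-pred (odd-<-reflect j (suc s) lt)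

    Leaves : Bool → Bool → (Vertex → Dir → Target) → Terminal → Dir → Set
    Leaves pK pN table t d = T (not (isInside (table (old t) d)))

    old-moves-leave-at-terminals : ∀ s → suc s < n → ∀ pK pN → pK ≡ inF s → pN ≡ inF last → ∀ table →
      Leaves pK pN table next viaArc → Leaves pK pN table origin viaArc →
      (pK ≡ true → Leaves pK pN table fwd₀ viaSide × Leaves pK pN table fwd₁ viaSide) →
      (pN ≡ true → Leaves pK pN table wrap₀ viaSide × Leaves pK pN table wrap₁ viaSide) →
      ∀ c → InBlocks s c → ∀ d → InBlocks s (move d c) ⊎ LeavesBy s pK pN table c d
    old-moves-leave-at-terminals s s<n pK pN eK eN table hA hZ hK hN (P , true) P< viaArc = arc-case (parity P) P<
      where
        arc-case : ∀ {P} → Parity P → P < double (suc s) → InBlocks s (U.arc (P , true)) ⊎ LeavesBy s pK pN table (P , true) viaArc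
        arc-case (even j) lt = inj₁ (subst (InBlocks s) (sym (arc-within j)) (s≤s (s≤s (double-mono-≤ j s (even-≤ j s lt)))))
        arc-case (odd j) lt with m≤n⇒m<n∨m≡n (odd-≤ j s lt)
        ... | inj₁ j<s = inj₁ (subst (InBlocks s) (sym (arc-between j (<-trans (s≤s j<s) s<n))) (double-mono-< (suc j) (suc s) (s≤s j<s)))
        ... | inj₂ refl = inj₂ (next , tt , refl , hA)
    old-moves-leave-at-terminals s s<n pK pN eK eN table hA hZ hK hN (zero , false) P< viaArc = inj₂ (origin , tt , refl , hZ)
    old-moves-leave-at-terminals s s<n pK pN eK eN table hA hZ hK hN (suc P , false) P< viaArc = inj₁ (<-trans (n<1+n P) P<)
    old-moves-leave-at-terminals s s<n pK pN eK eN table hA hZ hK hN (P , b) P< viaSide = by-position (side-position P b)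
      where
        side-case : ∀ {P} → Parity P → P < double (suc s) → keptAt L P ≡ true → proj₁ (sideF (P , b)) ≡ mate P →
                    InBlocks s (sideF (P , b)) ⊎ LeavesBy s pK pN table (P , b) viaSide
        side-case (even j) lt kept e with m≤n⇒m<n∨m≡n (even-≤ j s lt)
        ... | inj₁ j<s = inj₁ (subst (_< double (suc s)) (sym (trans e (trans (mate-even j) (mateEven-inner j (<-trans (s≤s j<s) s<n)))))
                                      (double-mono-≤ (suc (suc j)) (suc s) (s≤s j<s)))
        ... | inj₂ refl = inj₂ (fwd-leaves b)
          where
            pK≡ : pK ≡ true
            pK≡ = trans eK (trans (sym (kept-even s (<-trans (n<1+n s) s<n))) kept)
            fwd-leaves : ∀ b → LeavesBy s pK pN table (double s , b) viaSide
            fwd-leaves false = fwd₀ , subst T (sym pK≡) tt , refl , proj₁ (hK pK≡)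
            fwd-leaves true = fwd₁ , subst T (sym pK≡) tt , refl , proj₂ (hK pK≡)
        side-case (odd zero) lt kept e = inj₂ (wrap-leaves b)
          where
            pN≡ : pN ≡ true
            pN≡ = trans eN kept
            wrap-leaves : ∀ b → LeavesBy s pK pN table (1 , b) viaSide
            wrap-leaves false = wrap₀ , subst T (sym pN≡) tt , refl , proj₁ (hN pN≡)
            wrap-leaves true = wrap₁ , subst T (sym pN≡) tt , refl , proj₂ (hN pN≡)
        side-case (odd (suc j)) lt kept e =
          inj₁ (subst (_< double (suc s)) (sym (trans e (mate-odd (suc j)))) (<-trans (double-mono-< j (suc j) (n<1+n j)) (<-trans (n<1+n _) lt)))
        by-position : proj₁ (sideF (P , b)) ≡ P ⊎ (keptAt L P ≡ true × proj₁ (sideF (P , b)) ≡ mate P) →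
                      InBlocks s (sideF (P , b)) ⊎ LeavesBy s pK pN table (P , b) viaSide
        by-position (inj₁ e) = inj₁ (subst (_< double (suc s)) (sym e) P<)
        by-position (inj₂ (kept , e)) = side-case (parity P) P< kept e

    beyond : ∀ s P b → double (suc s) ≤ P → ¬ InBlocks s (P , b)
    beyond s P b le lt = <-irrefl refl (<-≤-trans lt le)

    next-block-beyond : ∀ s half b → ¬ InBlocks (suc s) (corner (suc (suc s)) half b)
    next-block-beyond s false b = beyond (suc s) _ b ≤-refl
    next-block-beyond s true b = beyond (suc s) _ b (n≤1+n _)

    last-block-beyond : ∀ s → suc (suc s) < n → ∀ half b → ¬ InBlocks (suc s) (corner last half b)
    last-block-beyond s lt false b = beyond (suc s) _ b (double-mono-≤ _ _ (≤-pred lt))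
    last-block-beyond s lt true b = beyond (suc s) _ b (≤-trans (double-mono-≤ _ _ (≤-pred lt)) (n≤1+n _))

    keptVertex-sound : ∀ s → suc (suc s) ≤ n → ∀ pK pN q → pK ≡ inF s → pN ≡ inF last → q ≡ inF (suc s) →
                       ∀ v → T (keptVertex pK pN q v) → keptAt L (proj₁ (emb s v)) ≡ true
    keptVertex-sound s le pK pN q eK eN eq (old fwd₀) h = trans (kept-even s (<-trans (n<1+n s) le)) (trans (sym eK) (Equivalence.to T-≡ h))
    keptVertex-sound s le pK pN q eK eN eq (old fwd₁) h = trans (kept-even s (<-trans (n<1+n s) le)) (trans (sym eK) (Equivalence.to T-≡ h))
    keptVertex-sound s le pK pN q eK eN eq (old wrap₀) h = trans (sym eN) (Equivalence.to T-≡ h)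
    keptVertex-sound s le pK pN q eK eN eq (old wrap₁) h = trans (sym eN) (Equivalence.to T-≡ h)
    keptVertex-sound s le pK pN q eK eN eq (new e₀) h = trans (kept-even (suc s) le) (trans (sym eq) (Equivalence.to T-≡ h))
    keptVertex-sound s le pK pN q eK eN eq (new e₁) h = trans (kept-even (suc s) le) (trans (sym eq) (Equivalence.to T-≡ h))
    keptVertex-sound s le pK pN q eK eN eq (new o₀) h = trans (kept-odd s le) (trans (sym eK) (Equivalence.to T-≡ h))
    keptVertex-sound s le pK pN q eK eN eq (new o₁) h = trans (kept-odd s le) (trans (sym eK) (Equivalence.to T-≡ h))

    middle-new-moves : ∀ s → suc (suc s) < n → ∀ first pK q pN → q ≡ inF (suc s) → pK ≡ inF s →
      (pK ≡ true → sideF (newCorner (suc s) o₀) ≡ emb s (old (if first then fwd₀ else fwd₁))) →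
      (pK ≡ true → sideF (newCorner (suc s) o₁) ≡ emb s (old (if first then fwd₁ else fwd₀))) →
      ∀ x d → Lands s (move d (newCorner (suc s) x)) (middleTable first pK q pN (new x) d)
    middle-new-moves s lt first pK q pN eq eK h₀ h₁ e₀ viaArc = refl
    middle-new-moves s lt first pK true pN eq eK h₀ h₁ e₀ viaSide =
      subst (λ z → ¬ InBlocks (suc s) z) (sym (side-next s false lt (sym eq))) (next-block-beyond s true true)
    middle-new-moves s lt first pK false pN eq eK h₀ h₁ e₀ viaSide = sideF-deleted _ false (trans (kept-even (suc s) (<-trans (n<1+n _) lt)) (sym eq))
    middle-new-moves s lt first pK q pN eq eK h₀ h₁ e₁ viaArc = arc-within (suc s)
    middle-new-moves s lt first pK true pN eq eK h₀ h₁ e₁ viaSide =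
      subst (λ z → ¬ InBlocks (suc s) z) (sym (side-next s true lt (sym eq))) (next-block-beyond s true false)
    middle-new-moves s lt first pK false pN eq eK h₀ h₁ e₁ viaSide = sideF-deleted _ true (trans (kept-even (suc s) (<-trans (n<1+n _) lt)) (sym eq))
    middle-new-moves s lt first pK q pN eq eK h₀ h₁ o₀ viaArc = refl
    middle-new-moves s lt first true q pN eq eK h₀ h₁ o₀ viaSide = h₀ refl
    middle-new-moves s lt first false q pN eq eK h₀ h₁ o₀ viaSide = sideF-deleted _ false (trans (kept-odd s (<-trans (n<1+n _) lt)) (sym eK))
    middle-new-moves s lt first pK q pN eq eK h₀ h₁ o₁ viaArc =
      subst (λ z → ¬ InBlocks (suc s) z) (sym (arc-between (suc s) lt)) (next-block-beyond s false false)
    middle-new-moves s lt first true q pN eq eK h₀ h₁ o₁ viaSide = h₁ refl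
    middle-new-moves s lt first false q pN eq eK h₀ h₁ o₁ viaSide = sideF-deleted _ true (trans (kept-odd s (<-trans (n<1+n _) lt)) (sym eK))

    middle-terminal-moves : ∀ s → suc (suc s) < n → ∀ first pK q pN → pN ≡ inF last →
      (pK ≡ true → sideF (loc s fwd₀) ≡ emb s (new (if first then o₀ else o₁))) →
      (pK ≡ true → sideF (loc s fwd₁) ≡ emb s (new (if first then o₁ else o₀))) →
      ∀ t d → T (present pK pN t) → T (not (isInside (middleTable first pK q pN (old t) d))) →
      Lands s (move d (loc s t)) (middleTable first pK q pN (old t) d)
    middle-terminal-moves s lt first pK q pN eN h₀ h₁ next viaArc p l = arc-between s (<-trans (n<1+n _) lt)
    middle-terminal-moves s lt first true q pN eN h₀ h₁ fwd₀ viaSide p l = h₀ refl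
    middle-terminal-moves s lt first true q pN eN h₀ h₁ fwd₁ viaSide p l = h₁ refl
    middle-terminal-moves s lt first pK q true eN h₀ h₁ wrap₀ viaSide p l =
      subst (λ z → ¬ InBlocks (suc s) z) (sym (side-wrap⁻¹ false (sym eN))) (last-block-beyond s lt false true)
    middle-terminal-moves s lt first pK q true eN h₀ h₁ wrap₁ viaSide p l =
      subst (λ z → ¬ InBlocks (suc s) z) (sym (side-wrap⁻¹ true (sym eN))) (last-block-beyond s lt false false)
    middle-terminal-moves s lt first pK q pN eN h₀ h₁ origin viaArc p l =
      subst (λ z → ¬ InBlocks (suc s) z) (sym arc-back-around) (last-block-beyond s lt true true)

    middle-leaves-fwd : ∀ first pK q pN → pK ≡ true → Leaves pK pN (middleTable first pK q pN) fwd₀ viaSide × Leaves pK pN (middleTable first pK q pN) fwd₁ viaSide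
    middle-leaves-fwd first true q pN refl = tt , tt

    middle-leaves-wrap : ∀ first pK q pN → pN ≡ true → Leaves pK pN (middleTable first pK q pN) wrap₀ viaSide × Leaves pK pN (middleTable first pK q pN) wrap₁ viaSide
    middle-leaves-wrap first pK q true refl = tt , tt

    firstBlock : ∀ pK q pN → pK ≡ inF 0 → q ≡ inF 1 → pN ≡ inF last → BlockGeometry 0 pK pN (middleTable true pK q pN) (keptVertex pK pN q)
    firstBlock pK q pN eK eq eN = record
      { bound = s≤s (s≤s z≤n)
      ; new-moves = middle-new-moves 0 (s≤s (s≤s (s≤s z≤n))) true pK q pN eq eK
                      (λ k → side-first⁻¹ false (trans (sym eK) k)) (λ k → side-first⁻¹ true (trans (sym eK) k))
      ; old-moves = old-moves-leave-at-terminals 0 (s≤s (s≤s z≤n)) pK pN eK eN (middleTable true pK q pN) tt tt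
                      (middle-leaves-fwd true pK q pN) (middle-leaves-wrap true pK q pN)
      ; terminal-moves = middle-terminal-moves 0 (s≤s (s≤s (s≤s z≤n))) true pK q pN eN
                      (λ k → side-first false (trans (sym eK) k)) (λ k → side-first true (trans (sym eK) k))
      ; kept-sound = keptVertex-sound 0 (s≤s (s≤s z≤n)) pK pN q eK eN eq }

    middleBlock : ∀ s → suc (suc (suc s)) < n → ∀ pK q pN → pK ≡ inF (suc s) → q ≡ inF (suc (suc s)) → pN ≡ inF last →
                  BlockGeometry (suc s) pK pN (middleTable false pK q pN) (keptVertex pK pN q)
    middleBlock s lt pK q pN eK eq eN = record
      { bound = <⇒≤ lt
      ; new-moves = middle-new-moves (suc s) lt false pK q pN eq eK
                      (λ k → side-prev s false lt′ (trans (sym eK) k)) (λ k → side-prev s true lt′ (trans (sym eK) k))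
      ; old-moves = old-moves-leave-at-terminals (suc s) lt′ pK pN eK eN (middleTable false pK q pN) tt tt
                      (middle-leaves-fwd false pK q pN) (middle-leaves-wrap false pK q pN)
      ; terminal-moves = middle-terminal-moves (suc s) lt false pK q pN eN
                      (λ k → side-next s false lt′ (trans (sym eK) k)) (λ k → side-next s true lt′ (trans (sym eK) k))
      ; kept-sound = keptVertex-sound (suc s) (<⇒≤ lt) pK pN q eK eN eq }
      where
        lt′ : suc (suc s) < n
        lt′ = <-trans (n<1+n _) lt

    last-new-moves : ∀ pK pN → pK ≡ inF (suc k) → pN ≡ inF last →
      ∀ x d → Lands (suc k) (move d (newCorner last x)) (lastTable pK pN (new x) d)
    last-new-moves pK pN eK eN e₀ viaArc = refl
    last-new-moves pK true eK eN e₀ viaSide = side-wrap false (sym eN)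
    last-new-moves pK false eK eN e₀ viaSide = sideF-deleted _ false (trans (kept-even last ≤-refl) (sym eN))
    last-new-moves pK pN eK eN e₁ viaArc = arc-within last
    last-new-moves pK true eK eN e₁ viaSide = side-wrap true (sym eN)
    last-new-moves pK false eK eN e₁ viaSide = sideF-deleted _ true (trans (kept-even last ≤-refl) (sym eN))
    last-new-moves pK pN eK eN o₀ viaArc = refl
    last-new-moves true pN eK eN o₀ viaSide = side-prev k false ≤-refl (sym eK)
    last-new-moves false pN eK eN o₀ viaSide = sideF-deleted _ false (trans (kept-odd (suc k) ≤-refl) (sym eK))
    last-new-moves pK pN eK eN o₁ viaArc = arc-around
    last-new-moves true pN eK eN o₁ viaSide = side-prev k true ≤-refl (sym eK)
    last-new-moves false pN eK eN o₁ viaSide = sideF-deleted _ true (trans (kept-odd (suc k) ≤-refl) (sym eK))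

    last-terminal-moves : ∀ pK pN → pK ≡ inF (suc k) → pN ≡ inF last →
      ∀ t d → T (present pK pN t) → T (not (isInside (lastTable pK pN (old t) d))) → Lands (suc k) (move d (loc (suc k) t)) (lastTable pK pN (old t) d)
    last-terminal-moves pK pN eK eN next viaArc p l = arc-between (suc k) ≤-refl
    last-terminal-moves true pN eK eN fwd₀ viaSide p l = side-next k false ≤-refl (sym eK)
    last-terminal-moves true pN eK eN fwd₁ viaSide p l = side-next k true ≤-refl (sym eK)
    last-terminal-moves pK true eK eN wrap₀ viaSide p l = side-wrap⁻¹ false (sym eN)
    last-terminal-moves pK true eK eN wrap₁ viaSide p l = side-wrap⁻¹ true (sym eN)
    last-terminal-moves pK pN eK eN origin viaArc p l = arc-back-around

    last-leaves-fwd : ∀ pK pN → pK ≡ true → Leaves pK pN (lastTable pK pN) fwd₀ viaSide × Leaves pK pN (lastTable pK pN) fwd₁ viaSide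
    last-leaves-fwd true pN refl = tt , tt

    last-leaves-wrap : ∀ pK pN → pN ≡ true → Leaves pK pN (lastTable pK pN) wrap₀ viaSide × Leaves pK pN (lastTable pK pN) wrap₁ viaSide
    last-leaves-wrap pK true refl = tt , tt

    lastBlock : ∀ pK pN → pK ≡ inF (suc k) → pN ≡ inF last → BlockGeometry (suc k) pK pN (lastTable pK pN) (keptVertex pK pN pN)
    lastBlock pK pN eK eN = record
      { bound = ≤-refl
      ; new-moves = last-new-moves pK pN eK eN
      ; old-moves = old-moves-leave-at-terminals (suc k) ≤-refl pK pN eK eN (lastTable pK pN) tt tt (last-leaves-fwd pK pN) (last-leaves-wrap pK pN)
      ; terminal-moves = last-terminal-moves pK pN eK eN
      ; kept-sound = keptVertex-sound (suc k) ≤-refl pK pN pN eK eN eN }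

    initialColour : Bool → Corner → Terminal
    initialColour c₀ (0 , false) = origin
    initialColour c₀ (0 , true) = if c₀ then fwd₁ else origin
    initialColour c₀ (1 , false) = if c₀ then fwd₁ else origin
    initialColour c₀ (1 , true) = next
    initialColour c₀ _ = origin

    next-origin : inF 0 ≡ false → inF last ≡ false → G.Conn (1 , true) (0 , false)
    next-origin e e′ = G.Conn-trans (G-side (s≤s (s≤s z≤n)) (sideF-deleted 1 true e′))
      (G.Conn-trans (G-arc (s≤s (s≤s z≤n)) refl) (G-side (s≤s z≤n) (sideF-deleted 0 true e)))

    fwd₁-next : inF last ≡ false → G.Conn (0 , true) (1 , true)
    fwd₁-next e′ = G.Conn-trans (G-arc (s≤s z≤n) (arc-within 0)) (G-side (s≤s (s≤s z≤n)) (sideF-deleted 1 false e′))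

    origin-wrap₀ : inF 0 ≡ false → G.Conn (0 , false) (1 , false)
    origin-wrap₀ e = G.Conn-trans (G-side (s≤s z≤n) (sideF-deleted 0 false e)) (G-arc (s≤s z≤n) (arc-within 0))

    valid₀ : ∀ b → U.valid (0 , b)
    valid₀ b = s≤s z≤n

    valid₁ : ∀ b → U.valid (1 , b)
    valid₁ b = s≤s (s≤s z≤n)

    not-block₀ : ∀ P b → 2 ≤ P → ¬ InBlocks 0 (P , b)
    not-block₀ P b le = beyond 0 P b le

    2≤last : 2 ≤ double last
    2≤last = s≤s (s≤s z≤n)

    initial-involutive : ∀ a b t → T (present a b t) → initialPairing a b (initialPairing a b t) ≡ t × T (present a b (initialPairing a b t))
    initial-involutive false false next p = refl , tt
    initial-involutive false false origin p = refl , tt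
    initial-involutive true false next p = refl , tt
    initial-involutive true false fwd₀ p = refl , tt
    initial-involutive true false fwd₁ p = refl , tt
    initial-involutive true false origin p = refl , tt
    initial-involutive false true next p = refl , tt
    initial-involutive false true wrap₀ p = refl , tt
    initial-involutive false true wrap₁ p = refl , tt
    initial-involutive false true origin p = refl , tt
    initial-involutive true true next p = refl , tt
    initial-involutive true true fwd₀ p = refl , tt
    initial-involutive true true fwd₁ p = refl , tt
    initial-involutive true true wrap₀ p = refl , tt
    initial-involutive true true wrap₁ p = refl , tt
    initial-involutive true true origin p = refl , tt

    initial-colour-loc : ∀ a b t → T (present a b t) → SamePath (initialPairing a b) (initialColour a (loc 0 t)) t
    initial-colour-loc false false next p = inj₁ refl
    initial-colour-loc false false origin p = inj₁ refl
    initial-colour-loc true false next p = inj₁ refl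
    initial-colour-loc true false fwd₀ p = inj₂ refl
    initial-colour-loc true false fwd₁ p = inj₁ refl
    initial-colour-loc true false origin p = inj₁ refl
    initial-colour-loc false true next p = inj₁ refl
    initial-colour-loc false true wrap₀ p = inj₂ refl
    initial-colour-loc false true wrap₁ p = inj₂ refl
    initial-colour-loc false true origin p = inj₁ refl
    initial-colour-loc true true next p = inj₁ refl
    initial-colour-loc true true fwd₀ p = inj₂ refl
    initial-colour-loc true true fwd₁ p = inj₁ refl
    initial-colour-loc true true wrap₀ p = inj₂ refl
    initial-colour-loc true true wrap₁ p = inj₂ refl
    initial-colour-loc true true origin p = inj₁ refl

    initial-colour-present : ∀ a b c → InBlocks 0 c → T (present a b (initialColour a c))
    initial-colour-present a b (0 , false) _ = tt
    initial-colour-present true b (0 , true) _ = tt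
    initial-colour-present false b (0 , true) _ = tt
    initial-colour-present true b (1 , false) _ = tt
    initial-colour-present false b (1 , false) _ = tt
    initial-colour-present a b (1 , true) _ = tt
    initial-colour-present a b (suc (suc P) , _) (s≤s (s≤s ()))

    initial-colour-moves : ∀ a b → a ≡ inF 0 → b ≡ inF last →
      ∀ c d → InBlocks 0 c → InBlocks 0 (move d c) → SamePath (initialPairing a b) (initialColour a c) (initialColour a (move d c))
    initial-colour-moves a b eq₀ eN (0 , false) viaArc _ m∈ =
      ⊥-elim (not-block₀ _ true (≤-trans 2≤last (n≤1+n _)) (subst (InBlocks 0) arc-back-around m∈))
    initial-colour-moves true b eq₀ eN (0 , false) viaSide _ m∈ = ⊥-elim (not-block₀ _ false (s≤s (s≤s z≤n)) (subst (InBlocks 0) (side-first false (sym eq₀)) m∈))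
    initial-colour-moves false b eq₀ eN (0 , false) viaSide _ _ rewrite sideF-deleted 0 false (sym eq₀) = inj₁ refl
    initial-colour-moves a b eq₀ eN (0 , true) viaArc _ _ = inj₁ refl
    initial-colour-moves true b eq₀ eN (0 , true) viaSide _ m∈ = ⊥-elim (not-block₀ _ true (s≤s (s≤s z≤n)) (subst (InBlocks 0) (side-first true (sym eq₀)) m∈))
    initial-colour-moves false b eq₀ eN (0 , true) viaSide _ _ rewrite sideF-deleted 0 true (sym eq₀) = inj₁ refl
    initial-colour-moves a b eq₀ eN (1 , false) viaArc _ _ = inj₁ refl
    initial-colour-moves a true eq₀ eN (1 , false) viaSide _ m∈ = ⊥-elim (not-block₀ _ true 2≤last (subst (InBlocks 0) (side-wrap⁻¹ false (sym eN)) m∈))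
    initial-colour-moves true false eq₀ eN (1 , false) viaSide _ _ rewrite sideF-deleted 1 false (sym eN) = inj₂ refl
    initial-colour-moves false false eq₀ eN (1 , false) viaSide _ _ rewrite sideF-deleted 1 false (sym eN) = inj₂ refl
    initial-colour-moves a b eq₀ eN (1 , true) viaArc _ m∈ = ⊥-elim (not-block₀ _ false ≤-refl (subst (InBlocks 0) (arc-between 0 (s≤s (s≤s z≤n))) m∈))
    initial-colour-moves a true eq₀ eN (1 , true) viaSide _ m∈ = ⊥-elim (not-block₀ _ false 2≤last (subst (InBlocks 0) (side-wrap⁻¹ true (sym eN)) m∈))
    initial-colour-moves true false eq₀ eN (1 , true) viaSide _ _ rewrite sideF-deleted 1 true (sym eN) = inj₂ refl
    initial-colour-moves false false eq₀ eN (1 , true) viaSide _ _ rewrite sideF-deleted 1 true (sym eN) = inj₂ refl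
    initial-colour-moves a b eq₀ eN (suc (suc P) , _) d (s≤s (s≤s ())) _

    initial-reaches-loc : ∀ a → a ≡ inF 0 → ∀ c → InBlocks 0 c → G.Conn c (loc 0 (initialColour a c))
    initial-reaches-loc a eq₀ (0 , false) _ = G.done
    initial-reaches-loc true eq₀ (0 , true) _ = G.done
    initial-reaches-loc false eq₀ (0 , true) _ = G-side (valid₀ true) (sideF-deleted 0 true (sym eq₀))
    initial-reaches-loc true eq₀ (1 , false) _ = G-arc (valid₁ false) refl
    initial-reaches-loc false eq₀ (1 , false) _ = G.Conn-trans (G-arc (valid₁ false) refl) (G-side (valid₀ true) (sideF-deleted 0 true (sym eq₀)))
    initial-reaches-loc a eq₀ (1 , true) _ = G.done
    initial-reaches-loc a eq₀ (suc (suc P) , _) (s≤s (s≤s ()))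

    initial-μ-connected : ∀ a b → a ≡ inF 0 → b ≡ inF last → ∀ t → T (present a b t) → G.Conn (loc 0 t) (loc 0 (initialPairing a b t))
    initial-μ-connected false false eq₀ eN next p = next-origin (sym eq₀) (sym eN)
    initial-μ-connected false false eq₀ eN origin p = GI.Conn-sym (valid₁ true) (next-origin (sym eq₀) (sym eN))
    initial-μ-connected true false eq₀ eN next p = GI.Conn-sym (valid₀ true) (fwd₁-next (sym eN))
    initial-μ-connected true false eq₀ eN fwd₀ p = G.done
    initial-μ-connected true false eq₀ eN fwd₁ p = fwd₁-next (sym eN)
    initial-μ-connected true false eq₀ eN origin p = G.done
    initial-μ-connected false true eq₀ eN next p = G.done
    initial-μ-connected false true eq₀ eN wrap₀ p = GI.Conn-sym (valid₀ false) (origin-wrap₀ (sym eq₀))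
    initial-μ-connected false true eq₀ eN wrap₁ p = G.done
    initial-μ-connected false true eq₀ eN origin p = origin-wrap₀ (sym eq₀)
    initial-μ-connected true true eq₀ eN next p = G.done
    initial-μ-connected true true eq₀ eN fwd₀ p = G.done
    initial-μ-connected true true eq₀ eN fwd₁ p = G-arc (valid₀ true) (arc-within 0)
    initial-μ-connected true true eq₀ eN wrap₀ p = GI.Conn-sym (valid₀ true) (G-arc (valid₀ true) (arc-within 0))
    initial-μ-connected true true eq₀ eN wrap₁ p = G.done
    initial-μ-connected true true eq₀ eN origin p = G.done

    initialInvariant : ∀ a b → a ≡ inF 0 → b ≡ inF last → Invariant 0 (initialPairing a b) a b
    initialInvariant a b eq₀ eN = record
      { colour = initialColour a ; μ-involutive = initial-involutive a b ; colour-moves = initial-colour-moves a b eq₀ eN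
      ; colour-loc = initial-colour-loc a b ; reaches-loc = initial-reaches-loc a eq₀ ; colour-present = initial-colour-present a b
      ; μ-connected = initial-μ-connected a b eq₀ eN }

  -- The automaton

  -- A state records, after some block s ≥ 1, whether edge s + 1 and edge n are kept and how the
  -- paths through blocks 0 … s pair up the present terminals; m4, m6 and m7 with q = false are the
  -- steps that close off a boundary component.
  data State : Set where
    m0 m1 m2 m3 m4 m5 m6 m7 m8 m9 m10 m11 : State

  states : List State
  states = m0 ∷ m1 ∷ m2 ∷ m3 ∷ m4 ∷ m5 ∷ m6 ∷ m7 ∷ m8 ∷ m9 ∷ m10 ∷ m11 ∷ []

  ∈states : ∀ st → st ∈ states
  ∈states m0 = here refl
  ∈states m1 = there (here refl)
  ∈states m2 = there (there (here refl))
  ∈states m3 = there (there (there (here refl)))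
  ∈states m4 = there (there (there (there (here refl))))
  ∈states m5 = there (there (there (there (there (here refl)))))
  ∈states m6 = there (there (there (there (there (there (here refl))))))
  ∈states m7 = there (there (there (there (there (there (there (here refl)))))))
  ∈states m8 = there (there (there (there (there (there (there (there (here refl))))))))
  ∈states m9 = there (there (there (there (there (there (there (there (there (here refl)))))))))
  ∈states m10 = there (there (there (there (there (there (there (there (there (there (here refl))))))))))
  ∈states m11 = there (there (there (there (there (there (there (there (there (there (there (here refl)))))))))))

  bools : List Bool
  bools = false ∷ true ∷ []

  ∈bools : ∀ b → b ∈ bools
  ∈bools false = here refl
  ∈bools true = there (here refl)

  pairing : State → Terminal → Terminal
  pairing m0 = matching ((next , origin) ∷ [])
  pairing m1 = matching ((next , wrap₀) ∷ (wrap₁ , origin) ∷ [])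
  pairing m2 = matching ((next , wrap₁) ∷ (wrap₀ , origin) ∷ [])
  pairing m3 = matching ((next , fwd₀) ∷ (fwd₁ , origin) ∷ [])
  pairing m4 = matching ((next , fwd₁) ∷ (fwd₀ , origin) ∷ [])
  pairing m5 = matching ((next , origin) ∷ (fwd₀ , fwd₁) ∷ [])
  pairing m6 = matching ((next , fwd₁) ∷ (fwd₀ , wrap₀) ∷ (wrap₁ , origin) ∷ [])
  pairing m7 = matching ((next , fwd₁) ∷ (fwd₀ , wrap₁) ∷ (wrap₀ , origin) ∷ [])
  pairing m8 = matching ((next , wrap₀) ∷ (fwd₀ , fwd₁) ∷ (wrap₁ , origin) ∷ [])
  pairing m9 = matching ((next , wrap₀) ∷ (fwd₀ , wrap₁) ∷ (fwd₁ , origin) ∷ [])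
  pairing m10 = matching ((next , wrap₁) ∷ (fwd₀ , fwd₁) ∷ (wrap₀ , origin) ∷ [])
  pairing m11 = matching ((next , wrap₁) ∷ (fwd₀ , wrap₀) ∷ (fwd₁ , origin) ∷ [])

  fwdKept : State → Bool
  fwdKept m0 = false
  fwdKept m1 = false
  fwdKept m2 = false
  fwdKept _ = true

  wrapKept : State → Bool
  wrapKept m0 = false
  wrapKept m3 = false
  wrapKept m4 = false
  wrapKept m5 = false
  wrapKept _ = true

  start : Bool → Bool → Bool → State
  start false false false = m0
  start false false true = m4
  start false true false = m2
  start false true true = m7
  start true false false = m0
  start true false true = m3
  start true true false = m1
  start true true true = m9

  branch : {A : Set} → A → A → Bool → A
  branch x y false = x
  branch x y true = y

  δ : State → Bool → Maybe State
  δ m0 = branch (just m0) (just m4)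
  δ m1 = branch (just m1) (just m6)
  δ m2 = branch (just m2) (just m7)
  δ m3 = branch (just m0) (just m3)
  δ m4 = branch nothing (just m5)
  δ m5 = branch (just m0) (just m4)
  δ m6 = branch nothing (just m8)
  δ m7 = branch nothing (just m10)
  δ m8 = branch (just m1) (just m6)
  δ m9 = branch (just m2) (just m11)
  δ m10 = branch (just m2) (just m7)
  δ m11 = branch (just m1) (just m9)

  accepting : State → Bool
  accepting m2 = false
  accepting m4 = false
  accepting m10 = false
  accepting m11 = false
  accepting _ = true

  byTerminal : (a b c d e f : Terminal) → Terminal → Terminal
  byTerminal a b c d e f next = a
  byTerminal a b c d e f fwd₀ = b
  byTerminal a b c d e f fwd₁ = c
  byTerminal a b c d e f wrap₀ = d
  byTerminal a b c d e f wrap₁ = e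
  byTerminal a b c d e f origin = f

  byCorner : (a b c d : Terminal) → NewCorner → Terminal
  byCorner a b c d e₀ = a
  byCorner a b c d e₁ = b
  byCorner a b c d o₀ = c
  byCorner a b c d o₁ = d

  byVertex : (a b c d e f g h i j : Bool) → Vertex → Bool
  byVertex a b c d e f g h i j (old next) = a
  byVertex a b c d e f g h i j (old fwd₀) = b
  byVertex a b c d e f g h i j (old fwd₁) = c
  byVertex a b c d e f g h i j (old wrap₀) = d
  byVertex a b c d e f g h i j (old wrap₁) = e
  byVertex a b c d e f g h i j (old origin) = f
  byVertex a b c d e f g h i j (new e₀) = g
  byVertex a b c d e f g h i j (new e₁) = h
  byVertex a b c d e f g h i j (new o₀) = i
  byVertex a b c d e f g h i j (new o₁) = j

  Colouring : Set
  Colouring = (Terminal → Terminal) × (NewCorner → Terminal)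

  Separator : Set
  Separator = (Vertex → Bool) × Vertex

  -- The colour of each old terminal and new corner after the step: the terminal that ends its path.
  startColouring : Bool → Bool → Bool → Colouring
  startColouring false false false = byTerminal next origin origin origin origin next , byCorner next next next next
  startColouring false false true = byTerminal fwd₀ origin origin origin origin fwd₀ , byCorner fwd₀ next next next
  startColouring false true false = byTerminal next origin origin wrap₀ next wrap₀ , byCorner next next next next
  startColouring false true true = byTerminal fwd₀ origin origin wrap₀ fwd₀ wrap₀ , byCorner fwd₀ next next next
  startColouring true false false = byTerminal next next next origin origin next , byCorner next next next next
  startColouring true false true = byTerminal next fwd₁ next origin origin fwd₁ , byCorner next fwd₁ fwd₁ next
  startColouring true true false = byTerminal wrap₁ wrap₁ next next wrap₁ wrap₁ , byCorner wrap₁ wrap₁ wrap₁ next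
  startColouring true true true = byTerminal fwd₀ fwd₁ next next fwd₀ fwd₁ , byCorner fwd₀ fwd₁ fwd₁ next

  stepColouring : State → Bool → Colouring
  stepColouring m0 false = byTerminal next origin origin origin origin next , byCorner next next next next
  stepColouring m0 true = byTerminal fwd₀ origin origin origin origin fwd₀ , byCorner fwd₀ next next next
  stepColouring m1 false = byTerminal next origin origin next wrap₁ wrap₁ , byCorner next next next next
  stepColouring m1 true = byTerminal fwd₀ origin origin fwd₀ wrap₁ wrap₁ , byCorner fwd₀ next next next
  stepColouring m2 false = byTerminal next origin origin wrap₀ next wrap₀ , byCorner next next next next
  stepColouring m2 true = byTerminal fwd₀ origin origin wrap₀ fwd₀ wrap₀ , byCorner fwd₀ next next next
  stepColouring m3 false = byTerminal next next next origin origin next , byCorner next next next next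
  stepColouring m3 true = byTerminal next next fwd₁ origin origin fwd₁ , byCorner next fwd₁ fwd₁ next
  stepColouring m4 true = byTerminal fwd₀ next fwd₀ origin origin next , byCorner fwd₀ fwd₀ fwd₀ next
  stepColouring m5 false = byTerminal next next next origin origin next , byCorner next next next next
  stepColouring m5 true = byTerminal fwd₀ next next origin origin fwd₀ , byCorner fwd₀ next next next
  stepColouring m6 true = byTerminal fwd₀ next fwd₀ next wrap₁ wrap₁ , byCorner fwd₀ fwd₀ fwd₀ next
  stepColouring m7 true = byTerminal fwd₀ next fwd₀ wrap₀ next wrap₀ , byCorner fwd₀ fwd₀ fwd₀ next
  stepColouring m8 false = byTerminal next next next next wrap₁ wrap₁ , byCorner next next next next
  stepColouring m8 true = byTerminal fwd₀ next next fwd₀ wrap₁ wrap₁ , byCorner fwd₀ next next next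
  stepColouring m9 false = byTerminal wrap₀ next wrap₀ wrap₀ next wrap₀ , byCorner wrap₀ wrap₀ wrap₀ next
  stepColouring m9 true = byTerminal fwd₀ next fwd₁ fwd₀ next fwd₁ , byCorner fwd₀ fwd₁ fwd₁ next
  stepColouring m10 false = byTerminal next next next wrap₀ next wrap₀ , byCorner next next next next
  stepColouring m10 true = byTerminal fwd₀ next next wrap₀ fwd₀ wrap₀ , byCorner fwd₀ next next next
  stepColouring m11 false = byTerminal wrap₁ next wrap₁ next wrap₁ wrap₁ , byCorner wrap₁ wrap₁ wrap₁ next
  stepColouring m11 true = byTerminal fwd₀ next fwd₁ next fwd₀ fwd₁ , byCorner fwd₀ fwd₁ fwd₁ next
  stepColouring _ _ = byTerminal origin origin origin origin origin origin , byCorner origin origin origin origin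

  -- The marked vertices form a union of boundary components that misses the origin.
  stepSeparator : State → Bool → Separator
  stepSeparator m4 false = byVertex true false true true true false true true true false , old fwd₁
  stepSeparator m6 false = byVertex true false true false false false true true true false , old fwd₁
  stepSeparator m7 false = byVertex true false true false false false true true true false , old fwd₁
  stepSeparator _ _ = byVertex false false false false false false false false false false , old origin

  finalSeparator : State → Separator
  finalSeparator m2 = byVertex true true true false true false true false false false , old wrap₁
  finalSeparator m4 = byVertex true false true true true false true true true false , old fwd₁
  finalSeparator m10 = byVertex true false false false true false true false false false , old wrap₁
  finalSeparator m11 = byVertex true false false false true false true false false false , old wrap₁
  finalSeparator _ = byVertex false false false false false false false false false false , old origin

  flagsAfter : State → Bool → Bool → Bool
  flagsAfter st′ q pN = ⌊ fwdKept st′ Bool.≟ q ⌋ ∧ ⌊ wrapKept st′ Bool.≟ pN ⌋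

  startCertified : Bool → Bool → Bool → Bool
  startCertified c₀ cN q = flagsAfter (start c₀ cN q) q cN ∧
    StepChecks.certified c₀ cN q (initialPairing c₀ cN) (pairing (start c₀ cN q)) (middleTable true c₀ q cN)
      (proj₁ (startColouring c₀ cN q)) (proj₂ (startColouring c₀ cN q))

  certifyStep : State → Bool → Maybe State → Bool
  certifyStep st q (just st′) = flagsAfter st′ q (wrapKept st) ∧
    StepChecks.certified (fwdKept st) (wrapKept st) q (pairing st) (pairing st′) (middleTable false (fwdKept st) q (wrapKept st))
      (proj₁ (stepColouring st q)) (proj₂ (stepColouring st q))
  certifyStep st q nothing =
    SeparationChecks.certified (fwdKept st) (wrapKept st) (pairing st) (middleTable false (fwdKept st) q (wrapKept st))
      (keptVertex (fwdKept st) (wrapKept st) q) (proj₁ (stepSeparator st q)) (proj₂ (stepSeparator st q))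

  certifyFinal : State → Bool → Bool
  certifyFinal st true = ConnectionChecks.certified (fwdKept st) (wrapKept st) (pairing st) (lastTable (fwdKept st) (wrapKept st))
  certifyFinal st false =
    SeparationChecks.certified (fwdKept st) (wrapKept st) (pairing st) (lastTable (fwdKept st) (wrapKept st))
      (keptVertex (fwdKept st) (wrapKept st) (wrapKept st)) (proj₁ (finalSeparator st)) (proj₂ (finalSeparator st))

  starts-certified : T (allB (λ c₀ → allB (λ cN → allB (startCertified c₀ cN) bools) bools) bools)
  starts-certified = tt

  steps-certified : T (allB (λ st → allB (λ q → certifyStep st q (δ st q)) bools) states)
  steps-certified = tt

  finals-certified : T (allB (λ st → certifyFinal st (accepting st)) states)
  finals-certified = tt

  start-certified : ∀ c₀ cN q → T (startCertified c₀ cN q)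
  start-certified c₀ cN q =
    allB-elim (startCertified c₀ cN) (allB-elim (λ cN → allB (startCertified c₀ cN) bools)
      (allB-elim (λ c₀ → allB (λ cN → allB (startCertified c₀ cN) bools) bools) starts-certified (∈bools c₀)) (∈bools cN)) (∈bools q)

  step-certified : ∀ st q → T (certifyStep st q (δ st q))
  step-certified st q =
    allB-elim (λ q → certifyStep st q (δ st q)) (allB-elim (λ st → allB (λ q → certifyStep st q (δ st q)) bools) steps-certified (∈states st)) (∈bools q)

  final-certified : ∀ st → T (certifyFinal st (accepting st))
  final-certified st = allB-elim (λ st → certifyFinal st (accepting st)) finals-certified (∈states st)

  flagsAfter-sound : ∀ st′ q pN → T (flagsAfter st′ q pN) → fwdKept st′ ≡ q × wrapKept st′ ≡ pN
  flagsAfter-sound st′ q pN h = toWitness (T-∧ˡ {⌊ fwdKept st′ Bool.≟ q ⌋} h) , toWitness (T-∧ʳ {⌊ fwdKept st′ Bool.≟ q ⌋} h)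

  start-flags : ∀ c₀ cN q → fwdKept (start c₀ cN q) ≡ q × wrapKept (start c₀ cN q) ≡ cN
  start-flags c₀ cN q = flagsAfter-sound (start c₀ cN q) q cN (T-∧ˡ (start-certified c₀ cN q))

  start-facts : ∀ c₀ cN q → StepChecks.Facts c₀ cN q (initialPairing c₀ cN) (pairing (start c₀ cN q)) (middleTable true c₀ q cN)
                                               (proj₁ (startColouring c₀ cN q)) (proj₂ (startColouring c₀ cN q))
  start-facts c₀ cN q = StepChecks.facts c₀ cN q (initialPairing c₀ cN) (pairing (start c₀ cN q)) (middleTable true c₀ q cN)
    (proj₁ (startColouring c₀ cN q)) (proj₂ (startColouring c₀ cN q)) (T-∧ʳ {flagsAfter (start c₀ cN q) q cN} (start-certified c₀ cN q))

  step-certified-just : ∀ st q st′ → δ st q ≡ just st′ → T (certifyStep st q (just st′))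
  step-certified-just st q st′ e = subst (λ r → T (certifyStep st q r)) e (step-certified st q)

  step-flags : ∀ st q st′ → δ st q ≡ just st′ → fwdKept st′ ≡ q × wrapKept st′ ≡ wrapKept st
  step-flags st q st′ e = flagsAfter-sound st′ q (wrapKept st) (T-∧ˡ (step-certified-just st q st′ e))

  step-facts : ∀ st q st′ → δ st q ≡ just st′ →
    StepChecks.Facts (fwdKept st) (wrapKept st) q (pairing st) (pairing st′) (middleTable false (fwdKept st) q (wrapKept st))
                     (proj₁ (stepColouring st q)) (proj₂ (stepColouring st q))
  step-facts st q st′ e = StepChecks.facts (fwdKept st) (wrapKept st) q (pairing st) (pairing st′) (middleTable false (fwdKept st) q (wrapKept st))
    (proj₁ (stepColouring st q)) (proj₂ (stepColouring st q)) (T-∧ʳ {flagsAfter st′ q (wrapKept st)} (step-certified-just st q st′ e))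

  step-separation : ∀ st q → δ st q ≡ nothing →
    SeparationChecks.Facts (fwdKept st) (wrapKept st) (pairing st) (middleTable false (fwdKept st) q (wrapKept st))
                           (keptVertex (fwdKept st) (wrapKept st) q) (proj₁ (stepSeparator st q)) (proj₂ (stepSeparator st q))
  step-separation st q e = SeparationChecks.facts (fwdKept st) (wrapKept st) (pairing st) (middleTable false (fwdKept st) q (wrapKept st))
    (keptVertex (fwdKept st) (wrapKept st) q) (proj₁ (stepSeparator st q)) (proj₂ (stepSeparator st q))
    (subst (λ r → T (certifyStep st q r)) e (step-certified st q))

  final-connection : ∀ st → accepting st ≡ true → ∀ v → T (presentV (fwdKept st) (wrapKept st) v) →
    T (StepGraph.reach (fwdKept st) (wrapKept st) (pairing st) (lastTable (fwdKept st) (wrapKept st)) v (old origin))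
  final-connection st e = ConnectionChecks.reaches-origin (fwdKept st) (wrapKept st) (pairing st) (lastTable (fwdKept st) (wrapKept st))
    (subst (λ a → T (certifyFinal st a)) e (final-certified st))

  final-separation : ∀ st → accepting st ≡ false →
    SeparationChecks.Facts (fwdKept st) (wrapKept st) (pairing st) (lastTable (fwdKept st) (wrapKept st))
                           (keptVertex (fwdKept st) (wrapKept st) (wrapKept st)) (proj₁ (finalSeparator st)) (proj₂ (finalSeparator st))
  final-separation st e = SeparationChecks.facts (fwdKept st) (wrapKept st) (pairing st) (lastTable (fwdKept st) (wrapKept st))
    (keptVertex (fwdKept st) (wrapKept st) (wrapKept st)) (proj₁ (finalSeparator st)) (proj₂ (finalSeparator st))
    (subst (λ a → T (certifyFinal st a)) e (final-certified st))

  module Run (k : ℕ) (F : List Bool) where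
    open W¹Blocks k F

    Reached : ℕ → Maybe State → Set₁
    Reached s nothing = Separated
    Reached s (just st) = Lift (lsuc lzero) (Invariant s (pairing st) (fwdKept st) (wrapKept st) × fwdKept st ≡ inF s × wrapKept st ≡ inF last)

    reached-start : Reached 1 (just (start (inF 0) (inF last) (inF 1)))
    reached-start = lift (subst₂ (Invariant 1 (pairing (start (inF 0) (inF last) (inF 1)))) (sym fwd≡) (sym wrap≡) invariant′ , fwd≡ , wrap≡)
      where
        fwd≡ = proj₁ (start-flags (inF 0) (inF last) (inF 1))
        wrap≡ = proj₂ (start-flags (inF 0) (inF last) (inF 1))
        invariant′ = Step.invariant (firstBlock (inF 0) (inF 1) (inF last) refl refl refl) (initialInvariant (inF 0) (inF last) refl refl)
                       (start-facts (inF 0) (inF last) (inF 1))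

    advance : ∀ s → suc (suc (suc s)) < n → ∀ st → Invariant (suc s) (pairing st) (fwdKept st) (wrapKept st) →
              fwdKept st ≡ inF (suc s) → wrapKept st ≡ inF last → Reached (suc (suc s)) (δ st (inF (suc (suc s))))
    advance s lt st I eK eN with δ st (inF (suc (suc s))) in e
    ... | nothing = Separation.separated (middleBlock s lt (fwdKept st) (inF (suc (suc s))) (wrapKept st) eK refl eN) I
                      (step-separation st (inF (suc (suc s))) e)
    ... | just st′ = lift (subst₂ (Invariant (suc (suc s)) (pairing st′)) (sym fwd≡) (sym wrap≡) invariant′ , fwd≡ , trans wrap≡ eN)
      where
        fwd≡ = proj₁ (step-flags st (inF (suc (suc s))) st′ e)
        wrap≡ = proj₂ (step-flags st (inF (suc (suc s))) st′ e)
        invariant′ = Step.invariant (middleBlock s lt (fwdKept st) (inF (suc (suc s))) (wrapKept st) eK refl eN) I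
                       (step-facts st (inF (suc (suc s))) st′ e)

    -- the state after block s + 1, so after k it has read all but the last block
    after : ℕ → Maybe State
    after zero = just (start (inF 0) (inF last) (inF 1))
    after (suc s) = after s >>= λ st → δ st (inF (suc (suc s)))

    reached : ∀ s → s ≤ k → Reached (suc s) (after s)
    reached zero _ = reached-start
    reached (suc s) le = extend (after s) (reached s (≤-trans (n≤1+n s) le))
      where
        extend : ∀ m → Reached (suc s) m → Reached (suc (suc s)) (m >>= λ st → δ st (inF (suc (suc s))))
        extend nothing separated = separated
        extend (just st) (lift (I , eK , eN)) = advance s (s≤s (s≤s (s≤s le))) st I eK eN

    accepted : Bool
    accepted = maybe accepting false (after k)

    Outcome : Bool → Set₁
    Outcome true = Lift (lsuc lzero) (∀ c → U.valid c → G.Conn c (0 , false))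
    Outcome false = Separated

    finish : ∀ st → Invariant (suc k) (pairing st) (fwdKept st) (wrapKept st) → fwdKept st ≡ inF (suc k) → wrapKept st ≡ inF last →
             Outcome (accepting st)
    finish st I eK eN with accepting st in e
    ... | true = lift (Connection.all-connected (lastBlock (fwdKept st) (wrapKept st) eK eN) I refl (final-connection st e))
    ... | false = Separation.separated (lastBlock (fwdKept st) (wrapKept st) eK eN) I (final-separation st e)

    outcome : Outcome accepted
    outcome = from (after k) (reached k ≤-refl)
      where
        from : ∀ m → Reached (suc k) m → Outcome (maybe accepting false m)
        from nothing separated = separated
        from (just st) (lift (I , eK , eN)) = finish st I eK eN

    isQuasiTree≡accepted : isQuasiTree (restrict F L) ≡ accepted
    isQuasiTree≡accepted = decide (restrict F L) refl accepted outcome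
      where
        decide : ∀ R → restrict F L ≡ R → ∀ a → Outcome a → isQuasiTree R ≡ a
        decide [] e true _ = refl
        decide [] e false (S , cl , (P , b , P< , kept , s) , ¬s₀) = ⊥-elim (empty (subst (λ z → rank L P < length z) e (rank<length L P P< kept)))
          where
            empty : ∀ {x} → x < 0 → _
            empty ()
        decide (o ∷ os) e true (lift connected) = cong (_== 1) (Restricted.one-component o os e connected)
        decide (o ∷ os) e false (S , cl , (P , b , P< , kept , s) , ¬s₀) =
          ≢⇒== _ 1 (λ one → <-irrefl refl (subst (2 ≤_) one (Restricted.two-components o os e S cl P b P< kept s ¬s₀)))

  -- Counting accepted subsets

  feed : Maybe State → Bool → Maybe State
  feed m b = m >>= λ st → δ st b

  accepts : Maybe State → List Bool → Bool
  accepts m [] = maybe accepting false m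
  accepts m (b ∷ bs) = accepts (feed m b) bs

  count : Maybe State → ℕ → ℕ
  count m zero = bit (maybe accepting false m)
  count m (suc L) = count (feed m true) L + count (feed m false) L

  countB-++ : ∀ {A : Set} (p : A → Bool) xs ys → countB p (xs ++ ys) ≡ countB p xs + countB p ys
  countB-++ p [] ys = refl
  countB-++ p (x ∷ xs) ys = trans (cong (bit (p x) +_) (countB-++ p xs ys)) (sym (+-assoc (bit (p x)) _ _))

  countB-map : ∀ {A B : Set} (p : B → Bool) (f : A → B) xs → countB p (map f xs) ≡ countB (λ x → p (f x)) xs
  countB-map p f [] = refl
  countB-map p f (x ∷ xs) = cong (bit (p (f x)) +_) (countB-map p f xs)

  countB-cong : ∀ {A : Set} (p q : A → Bool) xs → (∀ x → x ∈ xs → p x ≡ q x) → countB p xs ≡ countB q xs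
  countB-cong p q [] h = refl
  countB-cong p q (x ∷ xs) h = cong₂ (λ a b → bit a + b) (h x (here refl)) (countB-cong p q xs (λ y m → h y (there m)))

  allSubsets-length : ∀ m x → x ∈ allSubsets m → length x ≡ m
  allSubsets-length zero .[] (here refl) = refl
  allSubsets-length (suc m) x mx with ∈-++⁻ (map (true ∷_) (allSubsets m)) mx
  ... | inj₁ mx₁ with ∈-map⁻ (true ∷_) mx₁
  ...   | y , my , refl = cong suc (allSubsets-length m y my)
  allSubsets-length (suc m) x mx | inj₂ mx₂ with ∈-map⁻ (false ∷_) mx₂
  ...   | y , my , refl = cong suc (allSubsets-length m y my)

  countB-allSubsets-head : ∀ m (p : List Bool → Bool) →
    countB p (allSubsets (suc m)) ≡ countB (λ G → p (true ∷ G)) (allSubsets m) + countB (λ G → p (false ∷ G)) (allSubsets m)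
  countB-allSubsets-head m p = trans (countB-++ p (map (true ∷_) (allSubsets m)) (map (false ∷_) (allSubsets m)))
    (cong₂ _+_ (countB-map p (true ∷_) (allSubsets m)) (countB-map p (false ∷_) (allSubsets m)))

  countB-allSubsets-last : ∀ m (p : List Bool → Bool) →
    countB p (allSubsets (suc m)) ≡ countB (λ w → p (w ++ true ∷ [])) (allSubsets m) + countB (λ w → p (w ++ false ∷ [])) (allSubsets m)
  countB-allSubsets-last zero p = cong₂ _+_ (sym (+-identityʳ (bit (p (true ∷ []))))) refl
  countB-allSubsets-last (suc m) p = begin
    countB p (allSubsets (suc (suc m)))
      ≡⟨ countB-allSubsets-head (suc m) p ⟩
    countB (λ G → p (true ∷ G)) (allSubsets (suc m)) + countB (λ G → p (false ∷ G)) (allSubsets (suc m))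
      ≡⟨ cong₂ _+_ (countB-allSubsets-last m (λ G → p (true ∷ G))) (countB-allSubsets-last m (λ G → p (false ∷ G))) ⟩
    (c true true + c true false) + (c false true + c false false)
      ≡⟨ interchange (c true true) (c true false) (c false true) (c false false) ⟩
    (c true true + c false true) + (c true false + c false false)
      ≡⟨ sym (cong₂ _+_ (countB-allSubsets-head m (λ w → p (w ++ true ∷ []))) (countB-allSubsets-head m (λ w → p (w ++ false ∷ [])))) ⟩
    countB (λ w → p (w ++ true ∷ [])) (allSubsets (suc m)) + countB (λ w → p (w ++ false ∷ [])) (allSubsets (suc m)) ∎
    where
      open ≡-Reasoning
      c : Bool → Bool → ℕ
      c first last = countB (λ w → p (first ∷ (w ++ last ∷ []))) (allSubsets m)
      interchange : ∀ a b c d → (a + b) + (c + d) ≡ (a + c) + (b + d)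
      interchange = solve-∀

  count-accepts : ∀ L m → countB (accepts m) (allSubsets L) ≡ count m L
  count-accepts zero m = +-identityʳ _
  count-accepts (suc L) m = trans (countB-allSubsets-head L (accepts m)) (cong₂ _+_ (count-accepts L _) (count-accepts L _))

  feedAt : Maybe State → List Bool → ℕ → Maybe State
  feedAt m G zero = m
  feedAt m G (suc s) = feed (feedAt m G s) (inSubset G (suc s))

  feedAt-cons : ∀ m b G s → feedAt m (b ∷ G) (suc s) ≡ feedAt (feed m b) G s
  feedAt-cons m b G zero = refl
  feedAt-cons m b G (suc s) = cong (λ z → feed z (inSubset G (suc s))) (feedAt-cons m b G s)

  feedAt-accepts : ∀ m w c → maybe accepting false (feedAt m (w ++ c ∷ []) (length w)) ≡ accepts m w
  feedAt-accepts m [] c = refl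
  feedAt-accepts m (b ∷ w) c = trans (cong (maybe accepting false) (feedAt-cons m b (w ++ c ∷ []) (length w))) (feedAt-accepts (feed m b) w c)

  inSubset-last : ∀ w c → inSubset (w ++ c ∷ []) (suc (length w)) ≡ c
  inSubset-last [] c = refl
  inSubset-last (b ∷ w) c = inSubset-last w c

  after≡feedAt : ∀ k c₀ q G s → Run.after k (c₀ ∷ q ∷ G) s ≡ feedAt (just (start c₀ (inSubset G (suc k)) q)) G s
  after≡feedAt k c₀ q G zero = refl
  after≡feedAt k c₀ q G (suc s) = cong (λ z → feed z (inSubset G (suc s))) (after≡feedAt k c₀ q G s)

  accepted≡accepts : ∀ k c₀ q cN w → length w ≡ k → Run.accepted k (c₀ ∷ q ∷ (w ++ cN ∷ [])) ≡ accepts (just (start c₀ cN q)) w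
  accepted≡accepts k c₀ q cN w refl = begin
    maybe accepting false (Run.after (length w) (c₀ ∷ q ∷ G) (length w))
      ≡⟨ cong (maybe accepting false) (after≡feedAt (length w) c₀ q G (length w)) ⟩
    maybe accepting false (feedAt (just (start c₀ (inSubset G (suc (length w))) q)) G (length w))
      ≡⟨ cong (λ c → maybe accepting false (feedAt (just (start c₀ c q)) G (length w))) (inSubset-last w cN) ⟩
    maybe accepting false (feedAt (just (start c₀ cN q)) G (length w))
      ≡⟨ feedAt-accepts (just (start c₀ cN q)) w cN ⟩
    accepts (just (start c₀ cN q)) w ∎
    where
      open ≡-Reasoning
      G = w ++ cN ∷ []

  startCount : ℕ → Bool → Bool → ℕ
  startCount k c₀ q = count (just (start c₀ true q)) k + count (just (start c₀ false q)) k

  κ-W¹-count : ∀ k → κ (suc (suc (suc k))) (W¹ (suc (suc (suc k)))) ≡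
    (startCount k true true + startCount k true false) + (startCount k false true + startCount k false false)
  κ-W¹-count k = begin
    κ (suc (suc (suc k))) (W¹ (suc (suc (suc k))))
      ≡⟨ countB-cong _ (Run.accepted k) (allSubsets (suc (suc (suc k)))) (λ F _ → Run.isQuasiTree≡accepted k F) ⟩
    countB (Run.accepted k) (allSubsets (suc (suc (suc k))))
      ≡⟨ countB-allSubsets-head (suc (suc k)) (Run.accepted k) ⟩
    countB (λ G → Run.accepted k (true ∷ G)) (allSubsets (suc (suc k))) + countB (λ G → Run.accepted k (false ∷ G)) (allSubsets (suc (suc k)))
      ≡⟨ cong₂ _+_ (by-first true) (by-first false) ⟩
    (startCount k true true + startCount k true false) + (startCount k false true + startCount k false false) ∎
    where
      open ≡-Reasoning
      by-last : ∀ c₀ q cN → countB (λ w → Run.accepted k (c₀ ∷ q ∷ (w ++ cN ∷ []))) (allSubsets k) ≡ count (just (start c₀ cN q)) k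
      by-last c₀ q cN = trans (countB-cong _ (accepts (just (start c₀ cN q))) (allSubsets k)
        (λ w mw → accepted≡accepts k c₀ q cN w (allSubsets-length k w mw))) (count-accepts k _)
      by-second : ∀ c₀ q → countB (λ G → Run.accepted k (c₀ ∷ q ∷ G)) (allSubsets (suc k)) ≡ startCount k c₀ q
      by-second c₀ q = trans (countB-allSubsets-last k _) (cong₂ _+_ (by-last c₀ q true) (by-last c₀ q false))
      by-first : ∀ c₀ → countB (λ G → Run.accepted k (c₀ ∷ G)) (allSubsets (suc (suc k))) ≡ startCount k c₀ true + startCount k c₀ false
      by-first c₀ = trans (countB-allSubsets-head (suc k) _) (cong₂ _+_ (by-second c₀ true) (by-second c₀ false))

  count-nothing : ∀ L → count nothing L ≡ 0
  count-nothing zero = refl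
  count-nothing (suc L) rewrite count-nothing L = refl

  closedForm : State → ℕ → ℕ
  closedForm m0 L = fib (suc L)
  closedForm m1 L = fib (suc (suc L))
  closedForm m2 L = fib L
  closedForm m3 L = fib (suc (suc L))
  closedForm m4 L = fib L
  closedForm m5 L = fib (suc L)
  closedForm m6 L = fib (suc L)
  closedForm m7 zero = 1
  closedForm m7 (suc L) = fib L
  closedForm m8 L = fib (suc (suc L))
  closedForm m9 zero = 1
  closedForm m9 (suc L) = fib L + closedForm m11 L
  closedForm m10 L = fib L
  closedForm m11 zero = 0
  closedForm m11 (suc L) = fib (suc (suc L)) + closedForm m9 L

  m7+fib : ∀ L → closedForm m7 L + fib L ≡ fib (suc L)
  m7+fib zero = refl
  m7+fib (suc L) = +-comm (fib L) (fib (suc L))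

  count-closedForm : ∀ st L → count (just st) L ≡ closedForm st L
  count-closedForm m0 zero = refl
  count-closedForm m0 (suc L) = trans (cong₂ _+_ (count-closedForm m4 L) (count-closedForm m0 L)) (+-comm (fib L) (fib (suc L)))
  count-closedForm m1 zero = refl
  count-closedForm m1 (suc L) = trans (cong₂ _+_ (count-closedForm m6 L) (count-closedForm m1 L)) (+-comm (fib (suc L)) _)
  count-closedForm m2 zero = refl
  count-closedForm m2 (suc L) = trans (cong₂ _+_ (count-closedForm m7 L) (count-closedForm m2 L)) (m7+fib L)
  count-closedForm m3 zero = refl
  count-closedForm m3 (suc L) = cong₂ _+_ (count-closedForm m3 L) (count-closedForm m0 L)
  count-closedForm m4 zero = refl
  count-closedForm m4 (suc L) = trans (cong₂ _+_ (count-closedForm m5 L) (count-nothing L)) (+-identityʳ _)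
  count-closedForm m5 zero = refl
  count-closedForm m5 (suc L) = trans (cong₂ _+_ (count-closedForm m4 L) (count-closedForm m0 L)) (+-comm (fib L) (fib (suc L)))
  count-closedForm m6 zero = refl
  count-closedForm m6 (suc L) = trans (cong₂ _+_ (count-closedForm m8 L) (count-nothing L)) (+-identityʳ _)
  count-closedForm m7 zero = refl
  count-closedForm m7 (suc L) = trans (cong₂ _+_ (count-closedForm m10 L) (count-nothing L)) (+-identityʳ _)
  count-closedForm m8 zero = refl
  count-closedForm m8 (suc L) = trans (cong₂ _+_ (count-closedForm m6 L) (count-closedForm m1 L)) (+-comm (fib (suc L)) _)
  count-closedForm m9 zero = refl
  count-closedForm m9 (suc L) = trans (cong₂ _+_ (count-closedForm m11 L) (count-closedForm m2 L)) (+-comm (closedForm m11 L) (fib L))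
  count-closedForm m10 zero = refl
  count-closedForm m10 (suc L) = trans (cong₂ _+_ (count-closedForm m7 L) (count-closedForm m2 L)) (m7+fib L)
  count-closedForm m11 zero = refl
  count-closedForm m11 (suc L) = trans (cong₂ _+_ (count-closedForm m9 L) (count-closedForm m1 L)) (+-comm (closedForm m9 L) _)

  isEven : ℕ → ℕ
  isEven zero = 1
  isEven (suc zero) = 0
  isEven (suc (suc m)) = isEven m

  m9-parity : ∀ L → closedForm m9 L + 2 * isEven (suc L) ≡ fib (suc (suc L))
  m11-parity : ∀ L → closedForm m11 L + 2 * isEven L ≡ 2 * fib (suc L)
  m9-parity zero = refl
  m9-parity (suc L) = trans (+-assoc (fib L) (closedForm m11 L) _) (trans (cong (fib L +_) (m11-parity L)) (lemma (fib L) (fib (suc L))))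
    where
      lemma : ∀ a b → a + 2 * b ≡ (b + a) + b
      lemma = solve-∀
  m11-parity zero = refl
  m11-parity (suc L) = trans (+-assoc (fib (suc (suc L))) (closedForm m9 L) _) (trans (cong (fib (suc (suc L)) +_) (m9-parity L)) (lemma (fib (suc (suc L)))))
    where
      lemma : ∀ a → a + a ≡ 2 * a
      lemma = solve-∀

  -- Only m9 and m11 depend on the parity of the length; their defect 2·isEven is what produces (-1)ⁿ⁺¹.
  κ-W¹ : ∀ k → κ (suc (suc (suc k))) (W¹ (suc (suc (suc k)))) + 2 * isEven (suc k) ≡ 2 * fib (suc (suc (suc (suc k))))
  κ-W¹ k = begin
    κ (suc (suc (suc k))) (W¹ (suc (suc (suc k)))) + 2 * e
      ≡⟨ cong (_+ 2 * e) (trans (κ-W¹-count k) closed) ⟩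
    (((x + F2) + (F2 + F1)) + ((y + F0) + (F0 + F1))) + 2 * e
      ≡⟨ regroup x y F0 F1 e ⟩
    ((x + 2 * e) + (y + F0)) + ((F2 + (F2 + F1)) + (F0 + F1))
      ≡⟨ cong₂ (λ u v → (u + v) + ((F2 + (F2 + F1)) + (F0 + F1))) (m9-parity k) (m7+fib k) ⟩
    (F2 + F1) + ((F2 + (F2 + F1)) + (F0 + F1))
      ≡⟨ collect F0 F1 ⟩
    2 * ((F2 + F1) + F2) ∎
    where
      open ≡-Reasoning
      e = isEven (suc k)
      x = closedForm m9 k
      y = closedForm m7 k
      F0 = fib k
      F1 = fib (suc k)
      F2 = fib (suc (suc k))
      closed : (startCount k true true + startCount k true false) + (startCount k false true + startCount k false false) ≡
               ((x + F2) + (F2 + F1)) + ((y + F0) + (F0 + F1))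
      closed = cong₂ _+_ (cong₂ _+_ (cong₂ _+_ (count-closedForm m9 k) (count-closedForm m3 k)) (cong₂ _+_ (count-closedForm m1 k) (count-closedForm m0 k)))
                         (cong₂ _+_ (cong₂ _+_ (count-closedForm m7 k) (count-closedForm m4 k)) (cong₂ _+_ (count-closedForm m2 k) (count-closedForm m0 k)))
      regroup : ∀ x y a b e → (((x + (b + a)) + ((b + a) + b)) + ((y + a) + (a + b))) + 2 * e ≡
                              ((x + 2 * e) + (y + a)) + (((b + a) + ((b + a) + b)) + (a + b))
      regroup = solve-∀
      collect : ∀ a b → ((b + a) + b) + (((b + a) + ((b + a) + b)) + (a + b)) ≡ 2 * (((b + a) + b) + (b + a))
      collect = solve-∀

open import Defs
open import Data.Nat using (ℕ; suc; _≥_)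
open import Data.Integer using (ℤ; +_; -[1+_]; _+_; _-_; _*_; _^_)
open import Relation.Binary.PropositionalEquality using (_≡_)

import Data.Nat as ℕ
open import Data.Nat using (zero; z≤n; s≤s)
open import Data.Integer.Properties using (+◃n≡+n; *-assoc; *-identityˡ)
open import Data.Integer.Tactic.RingSolver using (solve-∀)
open import Relation.Binary.PropositionalEquality using (refl; sym; trans; cong; module ≡-Reasoning)
open W¹QuasiTrees using (κ-W¹; isEven)

-1^-parity : ∀ m → -[1+ 0 ] ^ m ≡ + 1 - + (2 ℕ.* isEven (suc m))
-1^-parity zero = refl
-1^-parity (suc zero) = refl
-1^-parity (suc (suc m)) = trans (sym (*-assoc -[1+ 0 ] -[1+ 0 ] (-[1+ 0 ] ^ m))) (trans (*-identityˡ (-[1+ 0 ] ^ m)) (-1^-parity m))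

cancel : ∀ a b → (a + b) - + 1 + (+ 1 - b) ≡ a
cancel = solve-∀

theorem5p5 : (n : ℕ) → n ≥ 3 →
    + κ n (W¹ n) ≡ + 2 * + fib (suc n) - + 1 + -[1+ 0 ] ^ (suc n)
theorem5p5 n@(suc (suc (suc k))) (s≤s (s≤s (s≤s z≤n))) = begin
  + κ n (W¹ n)                                          ≡⟨ sym (cancel (+ κ n (W¹ n)) (+ 2e)) ⟩
  (+ κ n (W¹ n) + + 2e) - + 1 + (+ 1 - + 2e)            ≡⟨ cong (λ z → z - + 1 + (+ 1 - + 2e)) (trans (cong +_ (κ-W¹ k)) (sym (+◃n≡+n _))) ⟩
  + 2 * + fib (suc n) - + 1 + (+ 1 - + 2e)              ≡⟨ cong (λ z → + 2 * + fib (suc n) - + 1 + z) (sym (-1^-parity (suc n))) ⟩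
  + 2 * + fib (suc n) - + 1 + -[1+ 0 ] ^ (suc n)        ∎
  where
    open ≡-Reasoning
    2e = 2 ℕ.* isEven (suc k)
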